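{- Let $p$ be a prime with $p\equiv 15$ or $27\pmod{28}$. For all integers $n,k\geq 0$ with $p\nmid n$, \[ c_{9,5}\left(8p^{2k+1}n+\frac{34p^{2k+2}+1}{7}\right)\equiv 0\pmod 2. \]
   Context: For complex $a,b$ the false theta function is $\Psi(a,b):=\sum_{n=0}^\infty a^{n(n+1)/2}b^{n(n-1)/2}-\sum_{n=-\infty}^{ -1}a^{n(n+1)/2}b^{n(n-1)/2}$. For positive integers $r,s$, the integers $c_{r,s}(n)$ ($n\ge 0$) are defined by the power series identity $\sum_{n=0}^\infty c_{r,s}(n)q^n=\dfrac{1}{\Psi(-q^r,q^s)}$ (the denominator is a power series in $q$ with constant term $1$). -}

module Defs where

open import Data.Nat as ℕ using (ℕ; zero; suc; _∸_; _≡ᵇ_)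
open import Data.Nat.DivMod using (_/_; _%_)
open import Data.Integer as ℤ using (ℤ; +_; -_; 0ℤ; 1ℤ)
open import Data.Bool using (if_then_else_)

tri : ℕ → ℕ
tri n = (n ℕ.* suc n) / 2

sgn : ℕ → ℤ
sgn e = if (e % 2) ≡ᵇ 0 then 1ℤ else - 1ℤ

sumTo : ℕ → (ℕ → ℤ) → ℤ
sumTo zero f = f 0
sumTo (suc N) f = sumTo N f ℤ.+ f (suc N)

ind : ℕ → ℕ → ℤ
ind a b = if a ≡ᵇ b then 1ℤ else 0ℤ

-- Coefficient of q^N in Ψ(-q^r, q^s)
--   = Σ_{n≥0} (-1)^{n(n+1)/2} q^{r·n(n+1)/2 + s·n(n-1)/2}
--   - Σ_{m≥1} (-1)^{m(m-1)/2} q^{r·m(m-1)/2 + s·m(m+1)/2}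
-- (terms n = -m, m ≥ 1, of the second sum).  For r,s ≥ 1 the exponent of the
-- n-th (resp. m-th) term is ≥ n (resp. ≥ m), so indices ≤ N suffice.
psiCoeff : ℕ → ℕ → ℕ → ℤ
psiCoeff r s N =
  sumTo N (λ n → sgn (tri n) ℤ.* ind (r ℕ.* tri n ℕ.+ s ℕ.* tri (n ∸ 1)) N)
  ℤ.- sumTo N (λ m → if m ≡ᵇ 0 then 0ℤ
                      else sgn (tri (m ∸ 1)) ℤ.* ind (r ℕ.* tri (m ∸ 1) ℕ.+ s ℕ.* tri m) N)

-- c is the coefficient sequence of 1/Ψ(-q^r,q^s):  (Σ c(n) q^n) · Ψ(-q^r,q^s) = 1
IsReciprocalCoeffs : ℕ → ℕ → (ℕ → ℤ) → Set
IsReciprocalCoeffs r s c =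
  (N : ℕ) → sumTo N (λ j → c j ℤ.* psiCoeff r s (N ∸ j)) ≡ ind N 0
  where open import Relation.Binary.PropositionalEquality using (_≡_)

module Submission where

-- Modulo 2 the signs in Ψ disappear, and Ψ(-q⁹, q⁵) ≡ F := Σ_{x∈ℤ} q^(7x²+2x).  Splitting x by parity
-- gives F = Q(q⁴) + q R(q⁴) with Q = Σ q^(7x²+x), R = Σ q^(7x²+8x+2), and the change of variables
-- (u , a) ↦ (a - u , -1 - u - a) on ℤ² shows that the odd part of R·F is F·P with P = Σ q^(7x²+10x+3).
-- As F⁸ = F(q⁸) over 𝔽₂, extracting the terms q^(8m+5) from 1/F = F⁷/F(q⁸) gives Σ c(8m+5) qᵐ ≡ P·Q.
-- A term qᵐ of P·Q needs 28m + 17 = (14a+10)² + (14b+1)², but for the m of the theorem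
-- 28m + 17 = p^(2k+1) (28n + 17p) with p ≡ 3 (mod 4) and p ∤ 28n + 17p.  Such a number is not a sum of
-- two squares: by Fermat's little theorem p ∣ x² + y² forces p ∣ x and p ∣ y, and descent lowers the exponent.

module PowerSeries where

  open import Algebra.Bundles using (CommutativeMonoid; CommutativeRing)
  import Algebra.Properties.CommutativeSemigroup as CommutativeSemigroupProperties
  open import Data.Bool.Base using (Bool; true; false; _∧_; _xor_)
  open import Data.Bool.Properties
    using (∧-assoc; ∧-comm; ∧-idem; ∧-zeroʳ; ∧-distribˡ-xor; ∧-distribʳ-xor;
           xor-assoc; xor-comm; xor-same; xor-identityʳ; xor-∧-commutativeRing)
  open import Data.Nat.Base using (ℕ; zero; suc; _*_)
  open import Data.Nat.Properties using (suc-injective; *-distribˡ-+)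
  open import Data.Product.Base using (_,_)
  open import Function.Base using (_∘_)
  open import Level using (0ℓ)
  open import Relation.Binary.Bundles using (Setoid)
  open import Relation.Binary.PropositionalEquality

  private
    module Xor = CommutativeSemigroupProperties
      (CommutativeRing.+-commutativeSemigroup xor-∧-commutativeRing)

    xor-cancelˡ : ∀ x y → x xor (x xor y) ≡ y
    xor-cancelˡ x y = trans (sym (xor-assoc x x y)) (cong (_xor y) (xor-same x))

    ∧-distribʳ-scaled-xor : ∀ s x y z → ((s ∧ x) xor y) ∧ z ≡ (s ∧ (x ∧ z)) xor (y ∧ z)
    ∧-distribʳ-scaled-xor s x y z =
      trans (∧-distribʳ-xor z (s ∧ x) y) (cong (_xor (y ∧ z)) (∧-assoc s x z))

  -- Power series over 𝔽₂: coefficients are Bool, with xor as addition.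
  Series : Set
  Series = ℕ → Bool

  shift : Series → Series
  shift a n = a (suc n)

  infixl 7 _·_
  _·_ : Series → Series → Series
  (a · b) zero    = a 0 ∧ b 0
  (a · b) (suc n) = (a 0 ∧ b (suc n)) xor (shift a · b) n

  1ₛ : Series
  1ₛ zero    = true
  1ₛ (suc n) = false

  ·-cong : ∀ {a a′ b b′} → a ≗ a′ → b ≗ b′ → a · b ≗ a′ · b′
  ·-cong a≗a′ b≗b′ zero    = cong₂ _∧_ (a≗a′ 0) (b≗b′ 0)
  ·-cong a≗a′ b≗b′ (suc n) =
    cong₂ _xor_ (cong₂ _∧_ (a≗a′ 0) (b≗b′ (suc n))) (·-cong (a≗a′ ∘ suc) b≗b′ n)

  ·-unfoldʳ : ∀ a b n → (a · b) (suc n) ≡ (a (suc n) ∧ b 0) xor (a · shift b) n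
  ·-unfoldʳ a b zero    = xor-comm (a 0 ∧ b 1) (a 1 ∧ b 0)
  ·-unfoldʳ a b (suc n) = trans
    (cong ((a 0 ∧ b (suc (suc n))) xor_) (·-unfoldʳ (shift a) b n))
    (Xor.x∙yz≈y∙xz (a 0 ∧ b (suc (suc n))) (a (suc (suc n)) ∧ b 0) _)

  ·-comm : ∀ a b → a · b ≗ b · a
  ·-comm a b zero    = ∧-comm (a 0) (b 0)
  ·-comm a b (suc n) = begin
    (a 0 ∧ b (suc n)) xor (shift a · b) n  ≡⟨ cong₂ _xor_ (∧-comm (a 0) (b (suc n))) (·-comm (shift a) b n) ⟩
    (b (suc n) ∧ a 0) xor (b · shift a) n  ≡⟨ ·-unfoldʳ b a n ⟨
    (b · a) (suc n)                        ∎
    where open ≡-Reasoning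

  ·-linearˡ : ∀ s a b c →
    (λ n → (s ∧ a n) xor b n) · c ≗ (λ n → (s ∧ (a · c) n) xor (b · c) n)
  ·-linearˡ s a b c zero    = ∧-distribʳ-scaled-xor s (a 0) (b 0) (c 0)
  ·-linearˡ s a b c (suc n) = begin
    (((s ∧ a 0) xor b 0) ∧ c (suc n)) xor (_ · c) n
      ≡⟨ cong₂ _xor_ (∧-distribʳ-scaled-xor s (a 0) (b 0) (c (suc n))) (·-linearˡ s (shift a) (shift b) c n) ⟩
    ((s ∧ x) xor y) xor ((s ∧ x′) xor y′)  ≡⟨ Xor.interchange (s ∧ x) y (s ∧ x′) y′ ⟩
    ((s ∧ x) xor (s ∧ x′)) xor (y xor y′)  ≡⟨ cong (_xor (y xor y′)) (∧-distribˡ-xor s x x′) ⟨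
    (s ∧ (a · c) (suc n)) xor (b · c) (suc n)
      ∎
    where
    open ≡-Reasoning
    x = a 0 ∧ c (suc n)
    y = b 0 ∧ c (suc n)
    x′ = (shift a · c) n
    y′ = (shift b · c) n

  ·-assoc : ∀ a b c → (a · b) · c ≗ a · (b · c)
  ·-assoc a b c zero    = ∧-assoc (a 0) (b 0) (c 0)
  ·-assoc a b c (suc n) = begin
    ((a 0 ∧ b 0) ∧ c (suc n)) xor (shift (a · b) · c) n
      ≡⟨ cong₂ _xor_ (∧-assoc (a 0) (b 0) (c (suc n)))
                     (trans (·-linearˡ (a 0) (shift b) (shift a · b) c n)
                            (cong ((a 0 ∧ y) xor_) (·-assoc (shift a) b c n))) ⟩
    (a 0 ∧ x) xor ((a 0 ∧ y) xor z)  ≡⟨ xor-assoc (a 0 ∧ x) (a 0 ∧ y) z ⟨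
    ((a 0 ∧ x) xor (a 0 ∧ y)) xor z  ≡⟨ cong (_xor z) (∧-distribˡ-xor (a 0) x y) ⟨
    (a · (b · c)) (suc n)            ∎
    where
    open ≡-Reasoning
    x = b 0 ∧ c (suc n)
    y = (shift b · c) n
    z = (shift a · (b · c)) n

  ·-zeroˡ : ∀ a → (λ _ → false) · a ≗ (λ _ → false)
  ·-zeroˡ a zero    = refl
  ·-zeroˡ a (suc n) = ·-zeroˡ a n

  ·-identityˡ : ∀ a → 1ₛ · a ≗ a
  ·-identityˡ a zero    = refl
  ·-identityˡ a (suc n) = trans (cong (a (suc n) xor_) (·-zeroˡ a n)) (xor-identityʳ (a (suc n)))

  ·-identityʳ : ∀ a → a · 1ₛ ≗ a
  ·-identityʳ a n = trans (·-comm a 1ₛ n) (·-identityˡ a n)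

  ·-1-commutativeMonoid : CommutativeMonoid 0ℓ 0ℓ
  ·-1-commutativeMonoid = record
    { Carrier             = Series
    ; _≈_                 = _≗_
    ; _∙_                 = _·_
    ; ε                   = 1ₛ
    ; isCommutativeMonoid = record
      { isMonoid = record
        { isSemigroup = record
          { isMagma = record
            { isEquivalence = Setoid.isEquivalence (ℕ →-setoid Bool)
            ; ∙-cong        = ·-cong
            }
          ; assoc = ·-assoc
          }
        ; identity = ·-identityˡ , ·-identityʳ
        }
      ; comm = ·-comm
      }
    }

  open CommutativeMonoid ·-1-commutativeMonoid using ()
    renaming (∙-congˡ to ·-congˡ; ∙-congʳ to ·-congʳ)
  open CommutativeSemigroupProperties (CommutativeMonoid.commutativeSemigroup ·-1-commutativeMonoid)
    using (interchange; x∙yz≈y∙xz; xy∙z≈xz∙y)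

  ·-cancelʳ-invertible : ∀ {a b c f} → c · f ≗ 1ₛ → a · f ≗ b · f → a ≗ b
  ·-cancelʳ-invertible {a} {b} {c} {f} c·f≗1 a·f≗b·f = begin
    a            ≈⟨ ·-identityʳ a ⟨
    a · 1ₛ       ≈⟨ ·-congˡ (λ n → trans (sym (c·f≗1 n)) (·-comm c f n)) ⟩
    a · (f · c)  ≈⟨ ·-assoc a f c ⟨
    a · f · c    ≈⟨ ·-congʳ a·f≗b·f ⟩
    b · f · c    ≈⟨ ·-assoc b f c ⟩
    b · (f · c)  ≈⟨ ·-congˡ (λ n → trans (·-comm f c n) (c·f≗1 n)) ⟩
    b · 1ₛ       ≈⟨ ·-identityʳ b ⟩
    b            ∎
    where open import Relation.Binary.Reasoning.Setoid (ℕ →-setoid Bool)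

  dilate : Series → Series
  dilate a zero          = a 0
  dilate a (suc zero)    = false
  dilate a (suc (suc n)) = dilate (shift a) n

  dilate-cong : ∀ {a b} → a ≗ b → dilate a ≗ dilate b
  dilate-cong a≗b zero          = a≗b 0
  dilate-cong a≗b (suc zero)    = refl
  dilate-cong a≗b (suc (suc n)) = dilate-cong (a≗b ∘ suc) n

  frobenius : ∀ a → a · a ≗ dilate a
  frobenius a zero          = ∧-idem (a 0)
  frobenius a (suc zero)    = trans (cong ((a 0 ∧ a 1) xor_) (∧-comm (a 1) (a 0))) (xor-same (a 0 ∧ a 1))
  frobenius a (suc (suc n)) = begin
    x xor (shift a · a) (suc n)                ≡⟨ cong (x xor_) (·-unfoldʳ (shift a) a n) ⟩
    x xor ((a (suc (suc n)) ∧ a 0) xor y)      ≡⟨ cong (λ x′ → x xor (x′ xor y)) (∧-comm (a (suc (suc n))) (a 0)) ⟩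
    x xor (x xor y)                            ≡⟨ xor-cancelˡ x y ⟩
    y                                          ≡⟨ frobenius (shift a) n ⟩
    dilate (shift a) n                         ∎
    where
    open ≡-Reasoning
    x = a 0 ∧ a (suc (suc n))
    y = (shift a · shift a) n

  dilate-· : ∀ a b → dilate (a · b) ≗ dilate a · dilate b
  dilate-· a b = begin
    dilate (a · b)         ≈⟨ frobenius (a · b) ⟨
    (a · b) · (a · b)      ≈⟨ interchange a b a b ⟩
    (a · a) · (b · b)      ≈⟨ ·-cong (frobenius a) (frobenius b) ⟩
    dilate a · dilate b    ∎
    where open import Relation.Binary.Reasoning.Setoid (ℕ →-setoid Bool)

  double : ℕ → ℕ
  double zero    = zero
  double (suc n) = suc (suc (double n))

  double-injective : ∀ {m n} → double m ≡ double n → m ≡ n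
  double-injective {zero}  {zero}  _  = refl
  double-injective {suc m} {suc n} eq = cong suc (double-injective (suc-injective (suc-injective eq)))

  double≢suc-double : ∀ m n → double m ≢ suc (double n)
  double≢suc-double (suc m) (suc n) eq = double≢suc-double m n (suc-injective (suc-injective eq))

  double≡2* : ∀ n → double n ≡ 2 * n
  double≡2* zero    = refl
  double≡2* (suc n) = trans (cong (suc ∘ suc) (double≡2* n)) (sym (*-distribˡ-+ 2 1 n))

  evenPart oddPart : Series → Series
  evenPart a k = a (double k)
  oddPart  a k = a (suc (double k))

  dilate-double : ∀ a k → dilate a (double k) ≡ a k
  dilate-double a zero    = refl
  dilate-double a (suc k) = dilate-double (shift a) k

  dilate-suc-double : ∀ a k → dilate a (suc (double k)) ≡ false
  dilate-suc-double a zero    = refl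
  dilate-suc-double a (suc k) = dilate-suc-double (shift a) k

  evenPart≗dilate : ∀ a b → (∀ j → a (double (double j)) ≡ b j) →
    (∀ j → a (double (suc (double j))) ≡ false) → evenPart a ≗ dilate b
  evenPart≗dilate a b at-4j at-4j+2 zero          = at-4j 0
  evenPart≗dilate a b at-4j at-4j+2 (suc zero)    = at-4j+2 0
  evenPart≗dilate a b at-4j at-4j+2 (suc (suc k)) =
    evenPart≗dilate (shift (shift (shift (shift a)))) (shift b) (at-4j ∘ suc) (at-4j+2 ∘ suc) k

  evenPart-·-dilate : ∀ a b → evenPart (a · dilate b) ≗ evenPart a · b
  evenPart-·-dilate a b zero    = refl
  evenPart-·-dilate a b (suc k) = cong₂ _xor_
    (cong (a 0 ∧_) (dilate-double (shift b) k))
    (cong₂ _xor_ (trans (cong (a 1 ∧_) (dilate-suc-double b k)) (∧-zeroʳ (a 1)))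
                 (evenPart-·-dilate (shift (shift a)) b k))

  oddPart-·-dilate : ∀ a b → oddPart (a · dilate b) ≗ oddPart a · b
  oddPart-·-dilate a b zero    = cong (_xor (a 1 ∧ b 0)) (∧-zeroʳ (a 0))
  oddPart-·-dilate a b (suc k) = cong₂ _xor_
    (trans (cong (a 0 ∧_) (dilate-suc-double (shift b) k)) (∧-zeroʳ (a 0)))
    (cong₂ _xor_ (cong (a 1 ∧_) (dilate-double (shift b) k))
                 (oddPart-·-dilate (shift (shift a)) b k))

  -- Since F⁸ = F(q⁸), the series C = 1/F satisfies C · F(q⁸) = F · F(q²) · F(q⁴); the terms q^(8m+5)
  -- of the left side form (Σ C(8m+5) qᵐ) · F, those of the right side are computed from the 2-dissection of F.
  reciprocal-8m+5 : ∀ {C F P Q R} → C · F ≗ 1ₛ →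
    evenPart F ≗ dilate Q → oddPart F ≗ dilate R → oddPart (R · F) ≗ F · P →
    oddPart (evenPart (oddPart C)) ≗ P · Q
  reciprocal-8m+5 {C} {F} {P} {Q} {R} C·F≗1 evenF oddF oddRF = ·-cancelʳ-invertible C·F≗1 D·F≗P·Q·F
    where
    open import Relation.Binary.Reasoning.Setoid (ℕ →-setoid Bool)
    D T : Series
    D = oddPart (evenPart (oddPart C))
    T = F · dilate (F · dilate F)

    T·F≗F⁸ : T · F ≗ dilate (dilate (dilate F))
    T·F≗F⁸ = begin
      F · dilate (F · dilate F) · F       ≈⟨ xy∙z≈xz∙y F (dilate (F · dilate F)) F ⟩
      F · F · dilate (F · dilate F)       ≈⟨ ·-congʳ (frobenius F) ⟩
      dilate F · dilate (F · dilate F)    ≈⟨ dilate-· F (F · dilate F) ⟨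
      dilate (F · (F · dilate F))         ≈⟨ dilate-cong (·-assoc F F (dilate F)) ⟨
      dilate (F · F · dilate F)           ≈⟨ dilate-cong (·-congʳ (frobenius F)) ⟩
      dilate (dilate F · dilate F)        ≈⟨ dilate-cong (frobenius (dilate F)) ⟩
      dilate (dilate (dilate F))          ∎

    C·F⁸≗T : C · dilate (dilate (dilate F)) ≗ T
    C·F⁸≗T = begin
      C · dilate (dilate (dilate F))  ≈⟨ ·-congˡ T·F≗F⁸ ⟨
      C · (T · F)                     ≈⟨ x∙yz≈y∙xz C T F ⟩
      T · (C · F)                     ≈⟨ ·-congˡ C·F≗1 ⟩
      T · 1ₛ                          ≈⟨ ·-identityʳ T ⟩
      T                               ∎

    oddT : oddPart T ≗ F · dilate (R · F)
    oddT = begin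
      oddPart T                       ≈⟨ oddPart-·-dilate F (F · dilate F) ⟩
      oddPart F · (F · dilate F)      ≈⟨ ·-congʳ oddF ⟩
      dilate R · (F · dilate F)       ≈⟨ x∙yz≈y∙xz (dilate R) F (dilate F) ⟩
      F · (dilate R · dilate F)       ≈⟨ ·-congˡ (dilate-· R F) ⟨
      F · dilate (R · F)              ∎

    evenOddT : evenPart (oddPart T) ≗ R · F · dilate Q
    evenOddT = begin
      evenPart (oddPart T)            ≈⟨ oddT ∘ double ⟩
      evenPart (F · dilate (R · F))   ≈⟨ evenPart-·-dilate F (R · F) ⟩
      evenPart F · (R · F)            ≈⟨ ·-congʳ evenF ⟩
      dilate Q · (R · F)              ≈⟨ ·-comm (dilate Q) (R · F) ⟩
      R · F · dilate Q                ∎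

    D·F≗P·Q·F : D · F ≗ P · Q · F
    D·F≗P·Q·F = begin
      D · F                                      ≈⟨ oddPart-·-dilate (evenPart (oddPart C)) F ⟨
      oddPart (evenPart (oddPart C) · dilate F)  ≈⟨ evenPart-·-dilate (oddPart C) (dilate F) ∘ suc ∘ double ⟨
      oddPart (evenPart (oddPart C · dilate (dilate F)))
        ≈⟨ oddPart-·-dilate C (dilate (dilate F)) ∘ double ∘ suc ∘ double ⟨
      oddPart (evenPart (oddPart (C · dilate (dilate (dilate F)))))
        ≈⟨ C·F⁸≗T ∘ suc ∘ double ∘ double ∘ suc ∘ double ⟩
      oddPart (evenPart (oddPart T))             ≈⟨ evenOddT ∘ suc ∘ double ⟩
      oddPart (R · F · dilate Q)                 ≈⟨ oddPart-·-dilate (R · F) Q ⟩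
      oddPart (R · F) · Q                        ≈⟨ ·-congʳ oddRF ⟩
      F · P · Q                                  ≈⟨ ·-congʳ (·-comm F P) ⟩
      P · F · Q                                  ≈⟨ xy∙z≈xz∙y P F Q ⟩
      P · Q · F                                  ∎

module XorSum where

  open import Data.Bool.Base using (Bool; true; false; _∧_; _xor_)
  open import Data.Bool.Properties
    using (∧-comm; ∧-idem; ∧-zeroʳ; ∧-identityʳ; ∧-distribˡ-xor; xor-assoc; xor-identityʳ; ¬-not;
           xor-∧-commutativeRing)
  open import Algebra.Bundles using (CommutativeRing)
  import Algebra.Properties.CommutativeSemigroup as CommutativeSemigroupProperties
  open import Data.List.Base using (List; []; _∷_; _++_; map; cartesianProduct)
  open import Data.List.Membership.Propositional using (_∈_)
  open import Data.List.Relation.Unary.Any using (here; there)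
  import Data.List.Relation.Unary.All as All
  open import Data.List.Relation.Unary.Unique.Propositional using (Unique; []; _∷_)
  open import Data.Product.Base using (_×_; _,_; ∃-syntax)
  open import Function.Base using (_∘_)
  open import Relation.Binary.Definitions using (DecidableEquality)
  open import Relation.Nullary.Decidable using (Dec; does; yes; no; dec-true)
  open import Relation.Binary.PropositionalEquality

  private
    module Xor = CommutativeSemigroupProperties
      (CommutativeRing.+-commutativeSemigroup xor-∧-commutativeRing)

    variable
      A B : Set

  ∧-true : ∀ {a b} → a ∧ b ≡ true → a ≡ true × b ≡ true
  ∧-true {true} {true} _ = refl , refl

  witness : ∀ {P : Set} (d : Dec P) → does d ≡ true → P
  witness (yes p) _ = p

  ∧-by-implication : ∀ {a b} → (a ≡ true → b ≡ true) → a ∧ b ≡ a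
  ∧-by-implication {true}  a⇒b = a⇒b refl
  ∧-by-implication {false} a⇒b = refl

  ⨁ : List A → (A → Bool) → Bool
  ⨁ []       f = false
  ⨁ (x ∷ xs) f = f x xor ⨁ xs f

  syntax ⨁ xs (λ x → e) = ⨁[ x ∈ xs ] e

  Supported : List A → (A → Bool) → Set _
  Supported xs f = ∀ {x} → f x ≡ true → x ∈ xs

  ⨁-cong : ∀ xs {f g : A → Bool} → (∀ {x} → x ∈ xs → f x ≡ g x) → ⨁ xs f ≡ ⨁ xs g
  ⨁-cong []       f≗g = refl
  ⨁-cong (x ∷ xs) f≗g = cong₂ _xor_ (f≗g (here refl)) (⨁-cong xs (f≗g ∘ there))

  ⨁-false : ∀ xs {f : A → Bool} → (∀ {x} → x ∈ xs → f x ≡ false) → ⨁ xs f ≡ false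
  ⨁-false []       f≗0 = refl
  ⨁-false (x ∷ xs) f≗0 = cong₂ _xor_ (f≗0 (here refl)) (⨁-false xs (f≗0 ∘ there))

  ⨁-++ : ∀ xs ys (f : A → Bool) → ⨁ (xs ++ ys) f ≡ ⨁ xs f xor ⨁ ys f
  ⨁-++ []       ys f = refl
  ⨁-++ (x ∷ xs) ys f = trans (cong (f x xor_) (⨁-++ xs ys f)) (sym (xor-assoc (f x) _ _))

  ⨁-map : ∀ (h : B → A) xs (f : A → Bool) → ⨁ (map h xs) f ≡ ⨁ xs (f ∘ h)
  ⨁-map h []       f = refl
  ⨁-map h (x ∷ xs) f = cong (f (h x) xor_) (⨁-map h xs f)

  ⨁-xor : ∀ xs (f g : A → Bool) → ⨁[ x ∈ xs ] (f x xor g x) ≡ ⨁ xs f xor ⨁ xs g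
  ⨁-xor []       f g = refl
  ⨁-xor (x ∷ xs) f g =
    trans (cong ((f x xor g x) xor_) (⨁-xor xs f g)) (Xor.interchange (f x) (g x) _ _)

  ∧-distribˡ-⨁ : ∀ b xs (f : A → Bool) → b ∧ ⨁ xs f ≡ ⨁[ x ∈ xs ] (b ∧ f x)
  ∧-distribˡ-⨁ b []       f = ∧-zeroʳ b
  ∧-distribˡ-⨁ b (x ∷ xs) f =
    trans (∧-distribˡ-xor b (f x) (⨁ xs f)) (cong ((b ∧ f x) xor_) (∧-distribˡ-⨁ b xs f))

  ⨁-∧-⨁ : ∀ xs ys (f : A → Bool) (g : B → Bool) →
    ⨁ xs f ∧ ⨁ ys g ≡ ⨁[ x ∈ xs ] ⨁[ y ∈ ys ] (f x ∧ g y)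
  ⨁-∧-⨁ xs ys f g = begin
    ⨁ xs f ∧ ⨁ ys g                    ≡⟨ ∧-comm (⨁ xs f) (⨁ ys g) ⟩
    ⨁ ys g ∧ ⨁ xs f                    ≡⟨ ∧-distribˡ-⨁ (⨁ ys g) xs f ⟩
    ⨁[ x ∈ xs ] (⨁ ys g ∧ f x)
      ≡⟨ ⨁-cong xs (λ {x} _ → trans (∧-comm (⨁ ys g) (f x)) (∧-distribˡ-⨁ (f x) ys g)) ⟩
    ⨁[ x ∈ xs ] ⨁[ y ∈ ys ] (f x ∧ g y) ∎
    where open ≡-Reasoning

  ⨁-comm : ∀ xs ys (f : A → B → Bool) →
    ⨁[ x ∈ xs ] ⨁[ y ∈ ys ] f x y ≡ ⨁[ y ∈ ys ] ⨁[ x ∈ xs ] f x y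
  ⨁-comm []       ys f = sym (⨁-false ys {λ _ → false} (λ _ → refl))
  ⨁-comm (x ∷ xs) ys f =
    trans (cong (⨁ ys (f x) xor_) (⨁-comm xs ys f)) (sym (⨁-xor ys (f x) (λ y → ⨁[ x ∈ xs ] f x y)))

  ⨁-cartesianProduct : ∀ xs ys (f : A × B → Bool) →
    ⨁ (cartesianProduct xs ys) f ≡ ⨁[ x ∈ xs ] ⨁[ y ∈ ys ] f (x , y)
  ⨁-cartesianProduct []       ys f = refl
  ⨁-cartesianProduct (x ∷ xs) ys f = begin
    ⨁ (map (x ,_) ys ++ cartesianProduct xs ys) f                 ≡⟨ ⨁-++ (map (x ,_) ys) _ f ⟩
    ⨁ (map (x ,_) ys) f xor ⨁ (cartesianProduct xs ys) f          ≡⟨ cong₂ _xor_ (⨁-map (x ,_) ys f)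
                                                                               (⨁-cartesianProduct xs ys f) ⟩
    ⨁[ y ∈ ys ] f (x , y) xor ⨁[ x ∈ xs ] ⨁[ y ∈ ys ] f (x , y)  ∎
    where open ≡-Reasoning

  ⨁-unique : ∀ {xs c} {f : A → Bool} → Unique xs → c ∈ xs →
    (∀ {x} → x ∈ xs → f x ≡ true → x ≡ c) → f c ≡ true → ⨁ xs f ≡ true
  ⨁-unique {xs = _ ∷ xs} (x∉xs ∷ xs!) (here refl) only fc =
    trans (cong₂ _xor_ fc (⨁-false xs (λ y∈xs → ¬-not (λ fy → All.lookup x∉xs y∈xs (sym (only (there y∈xs) fy))))))
          (xor-identityʳ true)
  ⨁-unique {xs = _ ∷ xs} {f = f} (x∉xs ∷ xs!) (there c∈xs) only fc =
    trans (cong (_xor ⨁ xs f) (¬-not (λ fx → All.lookup x∉xs c∈xs (only (here refl) fx))))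
          (⨁-unique xs! c∈xs (only ∘ there) fc)

  ⨁≡true⇒∃ : ∀ xs {f : A → Bool} → ⨁ xs f ≡ true → ∃[ x ] x ∈ xs × f x ≡ true
  ⨁≡true⇒∃ (x ∷ xs) {f} ⨁≡true with f x in fx
  ... | true  = x , here refl , fx
  ... | false with x′ , x′∈xs , fx′ ← ⨁≡true⇒∃ xs ⨁≡true = x′ , there x′∈xs , fx′

  module _ (_≟_ : DecidableEquality A) where

    -- Double counting of the pairs (x , u) with σ u ≡ x.
    ⨁-reindex : ∀ {B : Set} {xs : List A} {ys : List B} {g : A → Bool} {h : B → Bool} (σ : B → A) →
      Unique xs → Unique ys → Supported xs g → Supported ys h →
      (∀ u → h u ≡ g (σ u)) →
      (∀ {u v} → h u ≡ true → h v ≡ true → σ u ≡ σ v → u ≡ v) →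
      (∀ {x} → g x ≡ true → ∃[ u ] σ u ≡ x) →
      ⨁ xs g ≡ ⨁ ys h
    ⨁-reindex {B} {xs} {ys} {g} {h} σ xs! ys! supp-g supp-h h≗g∘σ injective surjective = begin
      ⨁[ x ∈ xs ] g x
        ≡⟨ ⨁-cong xs (λ _ → ∧-by-implication fibre-nonempty) ⟨
      ⨁[ x ∈ xs ] (g x ∧ ⨁[ u ∈ ys ] match u x)
        ≡⟨ ⨁-cong xs (λ {x} _ → ∧-distribˡ-⨁ (g x) ys (λ u → match u x)) ⟩
      ⨁[ x ∈ xs ] ⨁[ u ∈ ys ] (g x ∧ match u x)
        ≡⟨ ⨁-comm xs ys _ ⟩
      ⨁[ u ∈ ys ] ⨁[ x ∈ xs ] (g x ∧ match u x)
        ≡⟨ ⨁-cong ys (λ {u} _ → ⨁-cong xs (λ {x} _ → g-redundant u x)) ⟩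
      ⨁[ u ∈ ys ] ⨁[ x ∈ xs ] (h u ∧ does (σ u ≟ x))
        ≡⟨ ⨁-cong ys (λ {u} _ → ∧-distribˡ-⨁ (h u) xs (λ x → does (σ u ≟ x))) ⟨
      ⨁[ u ∈ ys ] (h u ∧ ⨁[ x ∈ xs ] does (σ u ≟ x))
        ≡⟨ ⨁-cong ys (λ _ → ∧-by-implication image-counted) ⟩
      ⨁[ u ∈ ys ] h u
        ∎
      where
      open ≡-Reasoning

      match : B → A → Bool
      match u x = h u ∧ does (σ u ≟ x)

      fibre-nonempty : ∀ {x} → g x ≡ true → ⨁[ u ∈ ys ] match u x ≡ true
      fibre-nonempty {x} gx with u₀ , refl ← surjective gx =
        ⨁-unique ys! (supp-h hu₀) only (cong₂ _∧_ hu₀ (dec-true (σ u₀ ≟ σ u₀) refl))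
        where
        hu₀ : h u₀ ≡ true
        hu₀ = trans (h≗g∘σ u₀) gx
        only : ∀ {u} → u ∈ ys → match u (σ u₀) ≡ true → u ≡ u₀
        only {u} _ m with hu , σu≟σu₀ ← ∧-true m = injective hu hu₀ (witness (σ u ≟ σ u₀) σu≟σu₀)

      g-redundant : ∀ u x → g x ∧ match u x ≡ h u ∧ does (σ u ≟ x)
      g-redundant u x with σ u ≟ x
      ... | yes refl = begin
        g (σ u) ∧ (h u ∧ true)  ≡⟨ cong₂ _∧_ (sym (h≗g∘σ u)) (∧-identityʳ (h u)) ⟩
        h u ∧ h u               ≡⟨ ∧-idem (h u) ⟩
        h u                     ≡⟨ ∧-identityʳ (h u) ⟨
        h u ∧ true              ∎
      ... | no _     = trans (cong (g x ∧_) (∧-zeroʳ (h u))) (trans (∧-zeroʳ (g x)) (sym (∧-zeroʳ (h u))))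

      image-counted : ∀ {u} → h u ≡ true → ⨁[ x ∈ xs ] does (σ u ≟ x) ≡ true
      image-counted {u} hu = ⨁-unique xs! (supp-g (trans (sym (h≗g∘σ u)) hu)) only (dec-true (σ u ≟ σ u) refl)
        where
        only : ∀ {x} → x ∈ xs → does (σ u ≟ x) ≡ true → x ≡ σ u
        only {x} _ σu≟x = sym (witness (σ u ≟ x) σu≟x)

    ⨁-support : ∀ {xs ys : List A} {g : A → Bool} → Unique xs → Unique ys →
      Supported xs g → Supported ys g → ⨁ xs g ≡ ⨁ ys g
    ⨁-support xs! ys! supp-xs supp-ys =
      ⨁-reindex (λ x → x) xs! ys! supp-xs supp-ys (λ _ → refl) (λ _ _ eq → eq) (λ {x} _ → x , refl)

module IntegerParity where

  open import Data.Bool.Base using (Bool; true; false; _∧_; _xor_)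
  open import Data.Integer.Base using (ℤ; +_; -_; _+_; _-_; _*_; ∣_∣)
  open import Data.Integer.DivMod using (_%_; _/_; n%d<d; a≡a%n+[a/n]*n)
  open import Data.Integer.Divisibility using (_∣_; divides)
  open import Data.Integer.Properties using (abs-*; +-identityˡ; +-comm)
  open import Data.Integer.Tactic.RingSolver using (solve-∀)
  open import Data.Nat.Base as ℕ using (ℕ; suc; s≤s; _≡ᵇ_)
  open import Data.Nat.Properties as ℕ using (even≢odd)
  open import Data.Product.Base using (∃-syntax; _,_)
  open import Data.Sum.Base using (_⊎_; inj₁; inj₂)
  open import Relation.Binary.PropositionalEquality
  open import Relation.Nullary.Negation using (contradiction)

  ⟦_⟧ : Bool → ℤ
  ⟦ true  ⟧ = + 1
  ⟦ false ⟧ = + 0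

  ⟦xor⟧ : ∀ x y → ⟦ x xor y ⟧ ≡ ⟦ x ⟧ + ⟦ y ⟧ - + 2 * ⟦ x ⟧ * ⟦ y ⟧
  ⟦xor⟧ true  true  = refl
  ⟦xor⟧ true  false = refl
  ⟦xor⟧ false true  = refl
  ⟦xor⟧ false false = refl

  ⟦∧⟧ : ∀ x y → ⟦ x ∧ y ⟧ ≡ ⟦ x ⟧ * ⟦ y ⟧
  ⟦∧⟧ true  true  = refl
  ⟦∧⟧ true  false = refl
  ⟦∧⟧ false true  = refl
  ⟦∧⟧ false false = refl

  record HasParity (z : ℤ) (b : Bool) : Set where
    constructor _,_
    field
      half  : ℤ
      split : z ≡ ⟦ b ⟧ + + 2 * half

  HasParity-+ : ∀ {a b x y} → HasParity a x → HasParity b y → HasParity (a + b) (x xor y)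
  HasParity-+ {x = x} {y} (q , refl) (r , refl) =
    q + r + ⟦ x ⟧ * ⟦ y ⟧ ,
    trans (lemma ⟦ x ⟧ ⟦ y ⟧ q r) (cong (_+ + 2 * (q + r + ⟦ x ⟧ * ⟦ y ⟧)) (sym (⟦xor⟧ x y)))
    where
    lemma : ∀ X Y q r → (X + + 2 * q) + (Y + + 2 * r) ≡ (X + Y - + 2 * X * Y) + + 2 * (q + r + X * Y)
    lemma = solve-∀

  HasParity-* : ∀ {a b x y} → HasParity a x → HasParity b y → HasParity (a * b) (x ∧ y)
  HasParity-* {x = x} {y} (q , refl) (r , refl) =
    q * ⟦ y ⟧ + ⟦ x ⟧ * r + + 2 * q * r ,
    trans (lemma ⟦ x ⟧ ⟦ y ⟧ q r) (cong (_+ + 2 * (q * ⟦ y ⟧ + ⟦ x ⟧ * r + + 2 * q * r)) (sym (⟦∧⟧ x y)))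
    where
    lemma : ∀ X Y q r → (X + + 2 * q) * (Y + + 2 * r) ≡ X * Y + + 2 * (q * Y + X * r + + 2 * q * r)
    lemma = solve-∀

  HasParity-neg : ∀ {a x} → HasParity a x → HasParity (- a) x
  HasParity-neg {x = x} (q , refl) = - q - ⟦ x ⟧ , lemma ⟦ x ⟧ q
    where
    lemma : ∀ X q → - (X + + 2 * q) ≡ X + + 2 * (- q - X)
    lemma = solve-∀

  odd≢even : ∀ q r → + 1 + + 2 * q ≢ + 2 * r
  odd≢even q r eq = even≢odd ∣ r - q ∣ 0 (begin
    2 ℕ.* ∣ r - q ∣    ≡⟨ abs-* (+ 2) (r - q) ⟨
    ∣ + 2 * (r - q) ∣  ≡⟨ cong ∣_∣ (trans (lemma q r) (cong (_- + 2 * q) (sym eq))) ⟩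
    ∣ + 1 + + 2 * q - + 2 * q ∣ ≡⟨ cong ∣_∣ (lemma′ q) ⟩
    1                  ∎)
    where
    open ≡-Reasoning
    lemma : ∀ q r → + 2 * (r - q) ≡ + 2 * r - + 2 * q
    lemma = solve-∀
    lemma′ : ∀ q → + 1 + + 2 * q - + 2 * q ≡ + 1
    lemma′ = solve-∀

  HasParity-unique : ∀ {z x y} → HasParity z x → HasParity z y → x ≡ y
  HasParity-unique {x = true}  {true}  _        _        = refl
  HasParity-unique {x = false} {false} _        _        = refl
  HasParity-unique {x = true}  {false} (q , eq) (r , eq′) =
    contradiction (trans (sym eq) (trans eq′ (+-identityˡ (+ 2 * r)))) (odd≢even q r)
  HasParity-unique {x = false} {true}  (q , eq) (r , eq′) =
    contradiction (trans (sym eq′) (trans eq (+-identityˡ (+ 2 * q)))) (odd≢even r q)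

  parity : ℤ → Bool
  parity z = z % + 2 ≡ᵇ 1

  HasParity-parity : ∀ z → HasParity z (parity z)
  HasParity-parity z with z % + 2 | n%d<d z (+ 2) | a≡a%n+[a/n]*n z (+ 2)
  ... | 0 | _ | eq = z / + 2 , trans eq (lemma (+ 0) (z / + 2))
    where
    lemma : ∀ r q → r + q * + 2 ≡ r + + 2 * q
    lemma = solve-∀
  ... | 1 | _ | eq = z / + 2 , trans eq (lemma (+ 1) (z / + 2))
    where
    lemma : ∀ r q → r + q * + 2 ≡ r + + 2 * q
    lemma = solve-∀
  ... | suc (suc _) | s≤s (s≤s ()) | _

  parity-unique : ∀ {z b} → HasParity z b → parity z ≡ b
  parity-unique {z} = HasParity-unique (HasParity-parity z)

  parity-+ : ∀ a b → parity (a + b) ≡ parity a xor parity b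
  parity-+ a b = parity-unique (HasParity-+ (HasParity-parity a) (HasParity-parity b))

  parity-* : ∀ a b → parity (a * b) ≡ parity a ∧ parity b
  parity-* a b = parity-unique (HasParity-* (HasParity-parity a) (HasParity-parity b))

  parity-difference : ∀ a b → parity (a - b) ≡ parity a xor parity b
  parity-difference a b = parity-unique (HasParity-+ (HasParity-parity a) (HasParity-neg (HasParity-parity b)))

  parity≡false⇒2∣ : ∀ z → parity z ≡ false → + 2 ∣ z
  parity≡false⇒2∣ z even with q , eq ← HasParity-parity z rewrite even =
    divides ∣ q ∣ (trans (cong ∣_∣ (trans eq (+-identityˡ (+ 2 * q)))) (trans (abs-* (+ 2) q) (ℕ.*-comm 2 ∣ q ∣)))

  even-or-odd : ∀ z → ∃[ t ] (z ≡ + 2 * t ⊎ z ≡ + 2 * t + + 1)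
  even-or-odd z with parity z | HasParity-parity z
  ... | false | q , eq = q , inj₁ (trans eq (+-identityˡ (+ 2 * q)))
  ... | true  | q , eq = q , inj₂ (trans eq (+-comm (+ 1) (+ 2 * q)))

module ThetaSeries where

  open PowerSeries
  open XorSum
  open import Data.Bool.Base using (Bool; true; false; _∧_; _xor_)
  open import Data.Bool.Properties using (xor-identityʳ; ¬-not)
  open import Data.Integer.Base as ℤ using (ℤ; +_; -[1+_]; ∣_∣)
  import Data.Integer.Properties as ℤ
  open import Data.List.Base using (List; _++_; map; upTo; applyUpTo; cartesianProduct)
  open import Data.List.Properties using (map-applyUpTo)
  open import Data.List.Membership.Propositional using (_∈_)
  open import Data.List.Membership.Propositional.Properties
    using (∈-map⁺; ∈-map⁻; ∈-++⁺ˡ; ∈-++⁺ʳ; ∈-upTo⁺; ∈-upTo⁻; ∈-cartesianProduct⁺)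
  open import Data.List.Relation.Unary.Unique.Propositional using (Unique)
  open import Data.List.Relation.Unary.Unique.Propositional.Properties using (++⁺; map⁺; upTo⁺; cartesianProduct⁺)
  open import Data.Nat.Base using (ℕ; zero; suc; _+_; _∸_; _≤_; _<_; s≤s; _≡ᵇ_)
  open import Data.Nat.Properties
    using (_≟_; ≤-refl; ≤-trans; ≤-pred; <-≤-trans; <⇒≤; m≤m+n; m≤n+m; m∸n≤m; m+n∸m≡n; m+[n∸m]≡n)
  open import Data.Product.Base using (_×_; _,_; proj₁; proj₂; ∃-syntax)
  open import Function.Base using (_∘_)
  open import Function.Bundles using (_⇔_)
  open import Relation.Nullary.Decidable using (dec-true; dec-false; does-⇔)
  open import Relation.Binary.PropositionalEquality
  open import Relation.Nullary.Negation using (¬_)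

  ≡ᵇ-true⇒≡ : ∀ m n → (m ≡ᵇ n) ≡ true → m ≡ n
  ≡ᵇ-true⇒≡ m n = witness (m ≟ n)

  ⨁-upTo-suc : ∀ n (f : ℕ → Bool) → ⨁ (upTo (suc n)) f ≡ f 0 xor ⨁[ i ∈ upTo n ] f (suc i)
  ⨁-upTo-suc n f = cong (f 0 xor_) (begin
    ⨁ (applyUpTo suc n) f       ≡⟨ cong (λ is → ⨁ is f) (map-applyUpTo (λ i → i) suc n) ⟨
    ⨁ (map suc (upTo n)) f      ≡⟨ ⨁-map suc (upTo n) f ⟩
    ⨁[ i ∈ upTo n ] f (suc i)   ∎)
    where open ≡-Reasoning

  ·-as-⨁ : ∀ a b n → (a · b) n ≡ ⨁[ i ∈ upTo (suc n) ] (a i ∧ b (n ∸ i))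
  ·-as-⨁ a b zero    = sym (xor-identityʳ (a 0 ∧ b 0))
  ·-as-⨁ a b (suc n) = trans (cong ((a 0 ∧ b (suc n)) xor_) (·-as-⨁ (shift a) b n))
                             (sym (⨁-upTo-suc (suc n) (λ i → a i ∧ b (suc n ∸ i))))

  window : ℕ → List ℤ
  window B = map +_ (upTo B) ++ map -[1+_] (upTo B)

  window-unique : ∀ B → Unique (window B)
  window-unique B = ++⁺ (map⁺ ℤ.+-injective (upTo⁺ B)) (map⁺ ℤ.-[1+-injective (upTo⁺ B)) disjoint
    where
    disjoint : ∀ {x} → ¬ (x ∈ map +_ (upTo B) × x ∈ map -[1+_] (upTo B))
    disjoint (x∈₊ , x∈₋) with ∈-map⁻ +_ x∈₊ | ∈-map⁻ -[1+_] x∈₋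
    ... | _ , _ , refl | _ , _ , ()

  ∈-window : ∀ {B} x → ∣ x ∣ < B → x ∈ window B
  ∈-window (+ n)    n<B   = ∈-++⁺ˡ (∈-map⁺ +_ (∈-upTo⁺ n<B))
  ∈-window -[1+ n ] 1+n<B = ∈-++⁺ʳ (map +_ (upTo _)) (∈-map⁺ -[1+_] (∈-upTo⁺ (<⇒≤ 1+n<B)))

  box : ℕ → List (ℤ × ℤ)
  box B = cartesianProduct (window B) (window B)

  box-unique : ∀ B → Unique (box B)
  box-unique B = cartesianProduct⁺ (window-unique B) (window-unique B)

  AbsBounded : (ℤ → ℕ) → Set
  AbsBounded φ = ∀ x → ∣ x ∣ ≤ suc (φ x)

  -- The theta series Σ_{x∈ℤ} q^(φ x) over 𝔽₂.  For AbsBounded φ the window contains every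
  -- solution of φ x = N.
  θ : (ℤ → ℕ) → Series
  θ φ N = ⨁[ x ∈ window (2 + N) ] (φ x ≡ᵇ N)

  module _ {φ : ℤ → ℕ} (φ-bounded : AbsBounded φ) where

    bounded-solution : ∀ {x N B} → φ x ≡ N → 2 + N ≤ B → ∣ x ∣ < B
    bounded-solution {x} refl 2+N≤B = <-≤-trans (s≤s (φ-bounded x)) 2+N≤B

    θ-support : ∀ {N B} → 2 + N ≤ B → Supported (window B) (λ x → φ x ≡ᵇ N)
    θ-support {N} 2+N≤B {x} φx≡N = ∈-window x (bounded-solution (≡ᵇ-true⇒≡ (φ x) N φx≡N) 2+N≤B)

    θ-window : ∀ {N B} → 2 + N ≤ B → θ φ N ≡ ⨁[ x ∈ window B ] (φ x ≡ᵇ N)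
    θ-window {N} {B} 2+N≤B = ⨁-support ℤ._≟_ (window-unique (2 + N)) (window-unique B) (θ-support ≤-refl) (θ-support 2+N≤B)

    θ-vanishes : ∀ {N} → (∀ x → φ x ≢ N) → θ φ N ≡ false
    θ-vanishes {N} no-solution = ⨁-false (window (2 + N)) (λ {x} _ → dec-false (φ x ≟ N) (no-solution x))

  convolution-indicator : ∀ a b n → ⨁[ i ∈ upTo (suc n) ] ((a ≡ᵇ i) ∧ (b ≡ᵇ n ∸ i)) ≡ (a + b ≡ᵇ n)
  convolution-indicator a b n with a + b ≡ᵇ n in a+b≟n
  ... | true  = ⨁-unique (upTo⁺ (suc n)) (∈-upTo⁺ (s≤s a≤n)) only a-term
    where
    a+b≡n : a + b ≡ n
    a+b≡n = ≡ᵇ-true⇒≡ (a + b) n a+b≟n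
    a≤n : a ≤ n
    a≤n = subst (a ≤_) a+b≡n (m≤m+n a b)
    only : ∀ {i} → i ∈ upTo (suc n) → ((a ≡ᵇ i) ∧ (b ≡ᵇ n ∸ i)) ≡ true → i ≡ a
    only {i} _ e = sym (≡ᵇ-true⇒≡ a i (proj₁ (∧-true e)))
    a-term : ((a ≡ᵇ a) ∧ (b ≡ᵇ n ∸ a)) ≡ true
    a-term = cong₂ _∧_ (dec-true (a ≟ a) refl) (dec-true (b ≟ n ∸ a) (trans (sym (m+n∸m≡n a b)) (cong (_∸ a) a+b≡n)))
  ... | false = ⨁-false (upTo (suc n))
                  (λ i∈ → ¬-not (λ e → false≢true (trans (sym a+b≟n) (dec-true (a + b ≟ n) (a+b≡n i∈ e)))))
    where
    false≢true : false ≢ true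
    false≢true ()
    a+b≡n : ∀ {i} → i ∈ upTo (suc n) → ((a ≡ᵇ i) ∧ (b ≡ᵇ n ∸ i)) ≡ true → a + b ≡ n
    a+b≡n {i} i∈ e =
      trans (cong₂ _+_ (≡ᵇ-true⇒≡ a i (proj₁ (∧-true e))) (≡ᵇ-true⇒≡ b (n ∸ i) (proj₂ (∧-true e))))
                           (m+[n∸m]≡n (≤-pred (∈-upTo⁻ i∈)))

  module _ {φ ψ : ℤ → ℕ} (φ-bounded : AbsBounded φ) (ψ-bounded : AbsBounded ψ) where

    θ-reindex : ∀ {N M} (σ : ℤ → ℤ) → (∀ {t u} → σ t ≡ σ u → t ≡ u) →
      (∀ t → φ (σ t) ≡ N ⇔ ψ t ≡ M) → (∀ {x} → φ x ≡ N → ∃[ t ] σ t ≡ x) → θ φ N ≡ θ ψ M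
    θ-reindex {N} {M} σ σ-injective σ-preserves σ-onto =
      ⨁-reindex ℤ._≟_ σ (window-unique (2 + N)) (window-unique (2 + M))
        (θ-support φ-bounded ≤-refl) (θ-support ψ-bounded ≤-refl)
        (λ t → sym (does-⇔ (σ-preserves t) (φ (σ t) ≟ N) (ψ t ≟ M)))
        (λ _ _ → σ-injective) (λ {x} → σ-onto ∘ ≡ᵇ-true⇒≡ (φ x) N)

    box-support : ∀ {n B} → 2 + n ≤ B → Supported (box B) (λ (x , y) → φ x + ψ y ≡ᵇ n)
    box-support {n} 2+n≤B {x , y} e = ∈-cartesianProduct⁺
      (∈-window x (bounded-solution φ-bounded refl (≤-trans (s≤s (s≤s (m≤m+n (φ x) (ψ y)))) 2+n≤B′)))
      (∈-window y (bounded-solution ψ-bounded refl (≤-trans (s≤s (s≤s (m≤n+m (ψ y) (φ x)))) 2+n≤B′)))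
      where
      2+n≤B′ : 2 + (φ x + ψ y) ≤ _
      2+n≤B′ = subst (λ k → 2 + k ≤ _) (sym (≡ᵇ-true⇒≡ (φ x + ψ y) n e)) 2+n≤B

    θ-·-θ : ∀ n → (θ φ · θ ψ) n ≡ ⨁ (box (2 + n)) (λ (x , y) → φ x + ψ y ≡ᵇ n)
    θ-·-θ n = begin
      (θ φ · θ ψ) n
        ≡⟨ ·-as-⨁ (θ φ) (θ ψ) n ⟩
      ⨁[ i ∈ I ] (θ φ i ∧ θ ψ (n ∸ i))
        ≡⟨ ⨁-cong I (λ {i} i∈ → cong₂ _∧_ (θ-window φ-bounded {i} (s≤s (s≤s (≤-pred (∈-upTo⁻ i∈)))))
                                       (θ-window ψ-bounded {n ∸ i} (s≤s (s≤s (m∸n≤m n i))))) ⟩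
      ⨁[ i ∈ I ] (⨁[ x ∈ W ] (φ x ≡ᵇ i) ∧ ⨁[ y ∈ W ] (ψ y ≡ᵇ n ∸ i))
        ≡⟨ ⨁-cong I (λ {i} _ → ⨁-∧-⨁ W W (λ x → φ x ≡ᵇ i) (λ y → ψ y ≡ᵇ n ∸ i)) ⟩
      ⨁[ i ∈ I ] ⨁[ x ∈ W ] ⨁[ y ∈ W ] ((φ x ≡ᵇ i) ∧ (ψ y ≡ᵇ n ∸ i))
        ≡⟨ ⨁-comm I W (λ i x → ⨁[ y ∈ W ] ((φ x ≡ᵇ i) ∧ (ψ y ≡ᵇ n ∸ i))) ⟩
      ⨁[ x ∈ W ] ⨁[ i ∈ I ] ⨁[ y ∈ W ] ((φ x ≡ᵇ i) ∧ (ψ y ≡ᵇ n ∸ i))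
        ≡⟨ ⨁-cong W (λ {x} _ → ⨁-comm I W (λ i y → (φ x ≡ᵇ i) ∧ (ψ y ≡ᵇ n ∸ i))) ⟩
      ⨁[ x ∈ W ] ⨁[ y ∈ W ] ⨁[ i ∈ I ] ((φ x ≡ᵇ i) ∧ (ψ y ≡ᵇ n ∸ i))
        ≡⟨ ⨁-cong W (λ {x} _ → ⨁-cong W (λ {y} _ → convolution-indicator (φ x) (ψ y) n)) ⟩
      ⨁[ x ∈ W ] ⨁[ y ∈ W ] (φ x + ψ y ≡ᵇ n)
        ≡⟨ ⨁-cartesianProduct W W (λ (x , y) → φ x + ψ y ≡ᵇ n) ⟨
      ⨁ (box (2 + n)) (λ (x , y) → φ x + ψ y ≡ᵇ n)
        ∎
      where
      open ≡-Reasoning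
      I = upTo (suc n)
      W = window (2 + n)

module QuadraticTheta where

  open PowerSeries
  open XorSum
  open IntegerParity
  open ThetaSeries
  open import Data.Bool.Base using (true; false)
  open import Data.Empty using (⊥-elim)
  open import Data.Integer.Base using (ℤ; +_; -[1+_]; -_; _+_; _-_; _*_; ∣_∣)
  import Data.Integer.Properties as ℤ
  open import Data.Integer.Tactic.RingSolver using (solve-∀)
  open import Data.Nat.Base as ℕ using (ℕ; zero; suc; _≡ᵇ_; _≤_; NonZero; z≤n; s≤s)
  import Data.Nat.Properties as ℕ
  open import Data.Product.Base using (_×_; _,_; ∃-syntax)
  import Data.Product.Properties as Product
  open import Data.Sum.Base using (inj₁; inj₂)
  open import Function.Base using (_∘_)
  open import Function.Bundles using (mk⇔)
  open import Relation.Nullary.Decidable using (from-yes)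
  open import Relation.Binary.PropositionalEquality

  -- x ↦ a x² + b x + c; at x = -1-n it equals a n² + (2a - b) n + (a + c - b).
  quadratic : ℕ → ℕ → ℕ → ℤ → ℕ
  quadratic a b c (+ n)    = a ℕ.* n ℕ.* n ℕ.+ b ℕ.* n ℕ.+ c
  quadratic a b c -[1+ n ] = a ℕ.* n ℕ.* n ℕ.+ (2 ℕ.* a ℕ.∸ b) ℕ.* n ℕ.+ (a ℕ.+ c ℕ.∸ b)

  pos-quadratic : ∀ a b c n → + (a ℕ.* n ℕ.* n ℕ.+ b ℕ.* n ℕ.+ c) ≡ + a * + n * + n + + b * + n + + c
  pos-quadratic a b c n = begin
    + (a ℕ.* n ℕ.* n ℕ.+ b ℕ.* n ℕ.+ c)          ≡⟨ ℤ.pos-+ (a ℕ.* n ℕ.* n ℕ.+ b ℕ.* n) c ⟩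
    + (a ℕ.* n ℕ.* n ℕ.+ b ℕ.* n) + + c          ≡⟨ cong (_+ + c) (ℤ.pos-+ (a ℕ.* n ℕ.* n) (b ℕ.* n)) ⟩
    + (a ℕ.* n ℕ.* n) + + (b ℕ.* n) + + c        ≡⟨ cong (λ k → k + + (b ℕ.* n) + + c)
                                                        (trans (ℤ.pos-* (a ℕ.* n) n) (cong (_* + n) (ℤ.pos-* a n))) ⟩
    + a * + n * + n + + (b ℕ.* n) + + c          ≡⟨ cong (λ k → + a * + n * + n + k + + c) (ℤ.pos-* b n) ⟩
    + a * + n * + n + + b * + n + + c            ∎
    where open ≡-Reasoning

  pos-∸ : ∀ {m n} → n ≤ m → + (m ℕ.∸ n) ≡ + m - + n
  pos-∸ {m} {n} n≤m = sym (trans (ℤ.m-n≡m⊖n m n) (ℤ.⊖-≥ n≤m))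

  quadratic-ℤ : ∀ a b c → b ≤ 2 ℕ.* a → b ≤ a ℕ.+ c → ∀ x → + quadratic a b c x ≡ + a * x * x + + b * x + + c
  quadratic-ℤ a b c b≤2a b≤a+c (+ n)    = pos-quadratic a b c n
  quadratic-ℤ a b c b≤2a b≤a+c -[1+ n ] = begin
    + quadratic a b c -[1+ n ]
      ≡⟨ pos-quadratic a (2 ℕ.* a ℕ.∸ b) (a ℕ.+ c ℕ.∸ b) n ⟩
    + a * + n * + n + + (2 ℕ.* a ℕ.∸ b) * + n + + (a ℕ.+ c ℕ.∸ b)
      ≡⟨ cong₂ (λ k l → + a * + n * + n + k * + n + l)
               (trans (pos-∸ b≤2a) (cong (_- + b) (ℤ.pos-* 2 a)))
               (trans (pos-∸ b≤a+c) (cong (_- + b) (ℤ.pos-+ a c))) ⟩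
    + a * + n * + n + (+ 2 * + a - + b) * + n + (+ a + + c - + b)
      ≡⟨ lemma (+ a) (+ b) (+ c) (+ n) ⟩
    + a * - (+ 1 + + n) * - (+ 1 + + n) + + b * - (+ 1 + + n) + + c
      ≡⟨ cong (λ x → + a * x * x + + b * x + + c) (cong -_ (ℤ.pos-+ 1 n)) ⟨
    + a * -[1+ n ] * -[1+ n ] + + b * -[1+ n ] + + c
      ∎
    where
    open ≡-Reasoning
    lemma : ∀ a b c n → a * n * n + (+ 2 * a - b) * n + (a + c - b) ≡ a * - (+ 1 + n) * - (+ 1 + n) + b * - (+ 1 + n) + c
    lemma = solve-∀

  n≤a*n*n : ∀ a n .{{_ : NonZero a}} → n ≤ a ℕ.* n ℕ.* n
  n≤a*n*n a zero    = z≤n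
  n≤a*n*n a (suc k) = ℕ.m≤n*m (suc k) (a ℕ.* suc k) {{ℕ.m*n≢0 a (suc k)}}

  quadratic-bounded : ∀ a b c .{{_ : NonZero a}} → AbsBounded (quadratic a b c)
  quadratic-bounded a b c (+ n)    = ℕ.m≤n⇒m≤1+n (ℕ.≤-trans (n≤a*n*n a n) (ℕ.≤-trans (ℕ.m≤m+n _ _) (ℕ.m≤m+n _ _)))
  quadratic-bounded a b c -[1+ n ] = s≤s (ℕ.≤-trans (n≤a*n*n a n) (ℕ.≤-trans (ℕ.m≤m+n _ _) (ℕ.m≤m+n _ _)))

  F Q R P : Series
  F = θ (quadratic 7 2 0)
  Q = θ (quadratic 7 1 0)
  R = θ (quadratic 7 8 2)
  P = θ (quadratic 7 10 3)

  private
    F-ℤ : ∀ x → + quadratic 7 2 0 x ≡ + 7 * x * x + + 2 * x + + 0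
    F-ℤ = quadratic-ℤ 7 2 0 (from-yes (2 ℕ.≤? 14)) (from-yes (2 ℕ.≤? 7))
    Q-ℤ : ∀ x → + quadratic 7 1 0 x ≡ + 7 * x * x + + 1 * x + + 0
    Q-ℤ = quadratic-ℤ 7 1 0 (from-yes (1 ℕ.≤? 14)) (from-yes (1 ℕ.≤? 7))
    R-ℤ : ∀ x → + quadratic 7 8 2 x ≡ + 7 * x * x + + 8 * x + + 2
    R-ℤ = quadratic-ℤ 7 8 2 (from-yes (8 ℕ.≤? 14)) (from-yes (8 ℕ.≤? 9))
    P-ℤ : ∀ x → + quadratic 7 10 3 x ≡ + 7 * x * x + + 10 * x + + 3
    P-ℤ = quadratic-ℤ 7 10 3 (from-yes (10 ℕ.≤? 14)) (from-yes (10 ℕ.≤? 10))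

    pos-double : ∀ n → + double n ≡ + 2 * + n
    pos-double n = trans (cong +_ (double≡2* n)) (ℤ.pos-* 2 n)

    pos-double² : ∀ n → + double (double n) ≡ + 2 * (+ 2 * + n)
    pos-double² n = trans (pos-double (double n)) (cong (+ 2 *_) (pos-double n))

  F-exponent-even : ∀ t → quadratic 7 2 0 (+ 2 * t) ≡ double (double (quadratic 7 1 0 t))
  F-exponent-even t = ℤ.+-injective (begin
    + quadratic 7 2 0 (+ 2 * t)                          ≡⟨ F-ℤ (+ 2 * t) ⟩
    + 7 * (+ 2 * t) * (+ 2 * t) + + 2 * (+ 2 * t) + + 0  ≡⟨ lemma t ⟩
    + 2 * (+ 2 * (+ 7 * t * t + + 1 * t + + 0))          ≡⟨ cong (λ k → + 2 * (+ 2 * k)) (Q-ℤ t) ⟨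
    + 2 * (+ 2 * + quadratic 7 1 0 t)                    ≡⟨ pos-double² (quadratic 7 1 0 t) ⟨
    + double (double (quadratic 7 1 0 t))                ∎)
    where
    open ≡-Reasoning
    lemma : ∀ t → + 7 * (+ 2 * t) * (+ 2 * t) + + 2 * (+ 2 * t) + + 0 ≡ + 2 * (+ 2 * (+ 7 * t * t + + 1 * t + + 0))
    lemma = solve-∀

  F-exponent-odd : ∀ t → quadratic 7 2 0 (+ 2 * t + + 1) ≡ suc (double (double (quadratic 7 8 2 t)))
  F-exponent-odd t = ℤ.+-injective (begin
    + quadratic 7 2 0 (+ 2 * t + + 1)                                        ≡⟨ F-ℤ (+ 2 * t + + 1) ⟩
    + 7 * (+ 2 * t + + 1) * (+ 2 * t + + 1) + + 2 * (+ 2 * t + + 1) + + 0   ≡⟨ lemma t ⟩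
    + 1 + + 2 * (+ 2 * (+ 7 * t * t + + 8 * t + + 2))                        ≡⟨ cong (λ k → + 1 + + 2 * (+ 2 * k)) (R-ℤ t) ⟨
    + 1 + + 2 * (+ 2 * + quadratic 7 8 2 t)                                  ≡⟨ cong (λ k → + 1 + k) (pos-double² (quadratic 7 8 2 t)) ⟨
    + 1 + + double (double (quadratic 7 8 2 t))                              ≡⟨ ℤ.pos-+ 1 (double (double (quadratic 7 8 2 t))) ⟨
    + suc (double (double (quadratic 7 8 2 t)))                              ∎)
    where
    open ≡-Reasoning
    lemma : ∀ t → + 7 * (+ 2 * t + + 1) * (+ 2 * t + + 1) + + 2 * (+ 2 * t + + 1) + + 0
                ≡ + 1 + + 2 * (+ 2 * (+ 7 * t * t + + 8 * t + + 2))
    lemma = solve-∀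

  private
    double-injective² : ∀ {m n} → double (double m) ≡ double (double n) → m ≡ n
    double-injective² = double-injective ∘ double-injective

    2*-injective : ∀ {t u} → + 2 * t ≡ + 2 * u → t ≡ u
    2*-injective {t} {u} = ℤ.*-cancelˡ-≡ (+ 2) t u

    2*+1-injective : ∀ {t u} → + 2 * t + + 1 ≡ + 2 * u + + 1 → t ≡ u
    2*+1-injective {t} {u} eq = 2*-injective (trans (sym (lemma t)) (trans (cong (_- + 1) eq) (lemma u)))
      where
      lemma : ∀ t → + 2 * t + + 1 - + 1 ≡ + 2 * t
      lemma = solve-∀

  F-at-4j : ∀ j → F (double (double j)) ≡ Q j
  F-at-4j j = θ-reindex (quadratic-bounded 7 2 0) (quadratic-bounded 7 1 0) (+ 2 *_) 2*-injective
    (λ t → mk⇔ (λ e → double-injective² (trans (sym (F-exponent-even t)) e))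
               (λ e → trans (F-exponent-even t) (cong (double ∘ double) e)))
    onto
    where
    onto : ∀ {x} → quadratic 7 2 0 x ≡ double (double j) → ∃[ t ] + 2 * t ≡ x
    onto {x} e with even-or-odd x
    ... | t , inj₁ refl = t , refl
    ... | t , inj₂ refl = ⊥-elim (double≢suc-double (double j) _ (trans (sym e) (F-exponent-odd t)))

  F-at-4j+1 : ∀ j → F (suc (double (double j))) ≡ R j
  F-at-4j+1 j = θ-reindex (quadratic-bounded 7 2 0) (quadratic-bounded 7 8 2) (λ t → + 2 * t + + 1)
    2*+1-injective
    (λ t → mk⇔ (λ e → double-injective² (ℕ.suc-injective (trans (sym (F-exponent-odd t)) e)))
               (λ e → trans (F-exponent-odd t) (cong (suc ∘ double ∘ double) e)))
    onto
    where
    onto : ∀ {x} → quadratic 7 2 0 x ≡ suc (double (double j)) → ∃[ t ] + 2 * t + + 1 ≡ x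
    onto {x} e with even-or-odd x
    ... | t , inj₁ refl = ⊥-elim (double≢suc-double _ (double j) (trans (sym (F-exponent-even t)) e))
    ... | t , inj₂ refl = t , refl

  F-at-4j+2 : ∀ j → F (double (suc (double j))) ≡ false
  F-at-4j+2 j = θ-vanishes (quadratic-bounded 7 2 0) no-solution
    where
    no-solution : ∀ x → quadratic 7 2 0 x ≢ double (suc (double j))
    no-solution x e with even-or-odd x
    ... | t , inj₁ refl = double≢suc-double _ j (double-injective (trans (sym (F-exponent-even t)) e))
    ... | t , inj₂ refl = double≢suc-double (suc (double j)) _ (trans (sym e) (F-exponent-odd t))

  F-at-4j+3 : ∀ j → F (suc (double (suc (double j)))) ≡ false
  F-at-4j+3 j = θ-vanishes (quadratic-bounded 7 2 0) no-solution
    where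
    no-solution : ∀ x → quadratic 7 2 0 x ≢ suc (double (suc (double j)))
    no-solution x e with even-or-odd x
    ... | t , inj₁ refl = double≢suc-double _ (suc (double j)) (trans (sym (F-exponent-even t)) e)
    ... | t , inj₂ refl = double≢suc-double _ j
            (double-injective (ℕ.suc-injective (trans (sym (F-exponent-odd t)) e)))

  evenPart-F : evenPart F ≗ dilate Q
  evenPart-F = evenPart≗dilate F Q F-at-4j F-at-4j+2

  oddPart-F : oddPart F ≗ dilate R
  oddPart-F = evenPart≗dilate (shift F) R F-at-4j+1 F-at-4j+3

  rotate : ℤ × ℤ → ℤ × ℤ
  rotate (u , a) = a - u , - (u + a) - + 1

  private
    double-≡ᵇ : ∀ m n → (double m ≡ᵇ double n) ≡ (m ≡ᵇ n)
    double-≡ᵇ zero    zero    = refl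
    double-≡ᵇ zero    (suc n) = refl
    double-≡ᵇ (suc m) zero    = refl
    double-≡ᵇ (suc m) (suc n) = double-≡ᵇ m n

  rotation-exponent : ∀ u a → quadratic 7 8 2 (a - u) ℕ.+ quadratic 7 2 0 (- (u + a) - + 1)
                            ≡ suc (double (quadratic 7 2 0 u ℕ.+ quadratic 7 10 3 a))
  rotation-exponent u a = ℤ.+-injective (begin
    + (quadratic 7 8 2 w ℕ.+ quadratic 7 2 0 z)
      ≡⟨ ℤ.pos-+ (quadratic 7 8 2 w) (quadratic 7 2 0 z) ⟩
    + quadratic 7 8 2 w + + quadratic 7 2 0 z
      ≡⟨ cong₂ _+_ (R-ℤ w) (F-ℤ z) ⟩
    (+ 7 * w * w + + 8 * w + + 2) + (+ 7 * z * z + + 2 * z + + 0)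
      ≡⟨ lemma u a ⟩
    + 1 + + 2 * ((+ 7 * u * u + + 2 * u + + 0) + (+ 7 * a * a + + 10 * a + + 3))
      ≡⟨ cong (λ k → + 1 + + 2 * k) (cong₂ _+_ (F-ℤ u) (P-ℤ a)) ⟨
    + 1 + + 2 * (+ quadratic 7 2 0 u + + quadratic 7 10 3 a)
      ≡⟨ cong (λ k → + 1 + + 2 * k) (ℤ.pos-+ (quadratic 7 2 0 u) (quadratic 7 10 3 a)) ⟨
    + 1 + + 2 * + (quadratic 7 2 0 u ℕ.+ quadratic 7 10 3 a)
      ≡⟨ cong (λ k → + 1 + k) (pos-double (quadratic 7 2 0 u ℕ.+ quadratic 7 10 3 a)) ⟨
    + 1 + + double (quadratic 7 2 0 u ℕ.+ quadratic 7 10 3 a)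
      ≡⟨ ℤ.pos-+ 1 (double (quadratic 7 2 0 u ℕ.+ quadratic 7 10 3 a)) ⟨
    + suc (double (quadratic 7 2 0 u ℕ.+ quadratic 7 10 3 a))
      ∎)
    where
    open ≡-Reasoning
    w = a - u
    z = - (u + a) - + 1
    lemma : ∀ u a → (+ 7 * (a - u) * (a - u) + + 8 * (a - u) + + 2)
                  + (+ 7 * (- (u + a) - + 1) * (- (u + a) - + 1) + + 2 * (- (u + a) - + 1) + + 0)
                  ≡ + 1 + + 2 * ((+ 7 * u * u + + 2 * u + + 0) + (+ 7 * a * a + + 10 * a + + 3))
    lemma = solve-∀

  R·F-exponent-even : ∀ w t → HasParity (+ (quadratic 7 8 2 w ℕ.+ quadratic 7 2 0 (+ 2 * t - w))) false
  R·F-exponent-even w t = K , (begin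
    + (quadratic 7 8 2 w ℕ.+ quadratic 7 2 0 z)
      ≡⟨ ℤ.pos-+ (quadratic 7 8 2 w) (quadratic 7 2 0 z) ⟩
    + quadratic 7 8 2 w + + quadratic 7 2 0 z
      ≡⟨ cong₂ _+_ (R-ℤ w) (F-ℤ z) ⟩
    (+ 7 * w * w + + 8 * w + + 2) + (+ 7 * z * z + + 2 * z + + 0)
      ≡⟨ lemma w t ⟩
    + 0 + + 2 * K
      ∎)
    where
    open ≡-Reasoning
    z = + 2 * t - w
    K = + 7 * w * w - + 14 * t * w + + 14 * t * t + + 3 * w + + 2 * t + + 1
    lemma : ∀ w t → (+ 7 * w * w + + 8 * w + + 2)
                  + (+ 7 * (+ 2 * t - w) * (+ 2 * t - w) + + 2 * (+ 2 * t - w) + + 0)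
                  ≡ + 0 + + 2 * (+ 7 * w * w - + 14 * t * w + + 14 * t * t + + 3 * w + + 2 * t + + 1)
    lemma = solve-∀

  rotate-injective : ∀ {p p′} → rotate p ≡ rotate p′ → p ≡ p′
  rotate-injective {u , a} {u′ , a′} eq = cong₂ _,_
    (2*-injective (trans (u-from u a) (trans (cong (λ (w , z) → - w - z - + 1) eq) (sym (u-from u′ a′)))))
    (2*-injective (trans (a-from u a) (trans (cong (λ (w , z) → w - z - + 1) eq) (sym (a-from u′ a′)))))
    where
    u-from : ∀ u a → + 2 * u ≡ - (a - u) - (- (u + a) - + 1) - + 1
    u-from = solve-∀
    a-from : ∀ u a → + 2 * a ≡ (a - u) - (- (u + a) - + 1) - + 1
    a-from = solve-∀

  oddPart-R·F : oddPart (R · F) ≗ F · P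
  oddPart-R·F m = begin
    (R · F) N
      ≡⟨ θ-·-θ R-bounded F-bounded N ⟩
    ⨁ (box (2 ℕ.+ N)) (λ (w , z) → quadratic 7 8 2 w ℕ.+ quadratic 7 2 0 z ≡ᵇ N)
      ≡⟨ ⨁-reindex (Product.≡-dec ℤ._≟_ ℤ._≟_) rotate (box-unique (2 ℕ.+ N)) (box-unique (2 ℕ.+ m))
           (box-support R-bounded F-bounded ℕ.≤-refl) (box-support F-bounded P-bounded ℕ.≤-refl)
           preserves (λ _ _ → rotate-injective) onto ⟩
    ⨁ (box (2 ℕ.+ m)) (λ (u , a) → quadratic 7 2 0 u ℕ.+ quadratic 7 10 3 a ≡ᵇ m)
      ≡⟨ θ-·-θ F-bounded P-bounded m ⟨
    (F · P) m
      ∎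
    where
    open ≡-Reasoning
    N = suc (double m)
    F-bounded = quadratic-bounded 7 2 0
    R-bounded = quadratic-bounded 7 8 2
    P-bounded = quadratic-bounded 7 10 3

    preserves : ∀ ((u , a) : ℤ × ℤ) → (quadratic 7 2 0 u ℕ.+ quadratic 7 10 3 a ≡ᵇ m)
              ≡ (quadratic 7 8 2 (a - u) ℕ.+ quadratic 7 2 0 (- (u + a) - + 1) ≡ᵇ N)
    preserves (u , a) =
      sym (trans (cong (_≡ᵇ N) (rotation-exponent u a)) (double-≡ᵇ (quadratic 7 2 0 u ℕ.+ quadratic 7 10 3 a) m))

    w+z-w : ∀ w z → (w + z) - w ≡ z
    w+z-w = solve-∀

    onto : ∀ {(w , z) : ℤ × ℤ} → (quadratic 7 8 2 w ℕ.+ quadratic 7 2 0 z ≡ᵇ N) ≡ true → ∃[ p ] rotate p ≡ (w , z)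
    onto {w , z} e with even-or-odd (w + z)
    ... | t , inj₁ w+z≡2t = ⊥-elim (false≢true (HasParity-unique even-exponent odd-exponent))
      where
      false≢true : false ≢ true
      false≢true ()
      even-exponent : HasParity (+ N) false
      even-exponent = subst (λ k → HasParity (+ k) false)
        (trans (cong (λ z → quadratic 7 8 2 w ℕ.+ quadratic 7 2 0 z) (trans (cong (_- w) (sym w+z≡2t)) (w+z-w w z)))
               (≡ᵇ-true⇒≡ _ N e))
        (R·F-exponent-even w t)
      odd-exponent : HasParity (+ N) true
      odd-exponent = + m , trans (ℤ.pos-+ 1 (double m)) (cong (λ k → + 1 + k) (pos-double m))
    ... | t , inj₂ w+z≡2t+1 = (- t - + 1 , w - t - + 1) , cong₂ _,_ (lemma₁ w t)
      (trans (lemma₂ w t) (trans (cong (_- w) (sym w+z≡2t+1)) (w+z-w w z)))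
      where
      lemma₁ : ∀ w t → (w - t - + 1) - (- t - + 1) ≡ w
      lemma₁ = solve-∀
      lemma₂ : ∀ w t → - ((- t - + 1) + (w - t - + 1)) - + 1 ≡ (+ 2 * t + + 1) - w
      lemma₂ = solve-∀

  P·Q≡true⇒sum-of-two-squares : ∀ m → (P · Q) m ≡ true → ∃[ x ] ∃[ y ] x ℕ.* x ℕ.+ y ℕ.* y ≡ 28 ℕ.* m ℕ.+ 17
  P·Q≡true⇒sum-of-two-squares m P·Q≡true
    with (a , b) , _ , e ← ⨁≡true⇒∃ (box (2 ℕ.+ m))
           (trans (sym (θ-·-θ (quadratic-bounded 7 10 3) (quadratic-bounded 7 1 0) m)) P·Q≡true)
    = ∣ x ∣ , ∣ y ∣ , ℤ.+-injective (begin
      + (∣ x ∣ ℕ.* ∣ x ∣ ℕ.+ ∣ y ∣ ℕ.* ∣ y ∣)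
        ≡⟨ trans (ℤ.pos-+ (∣ x ∣ ℕ.* ∣ x ∣) _) (cong₂ _+_ (ℤ.pos-* ∣ x ∣ ∣ x ∣) (ℤ.pos-* ∣ y ∣ ∣ y ∣)) ⟩
      + ∣ x ∣ * + ∣ x ∣ + + ∣ y ∣ * + ∣ y ∣
        ≡⟨ cong₂ _+_ (square-abs x) (square-abs y) ⟩
      x * x + y * y
        ≡⟨ lemma a b ⟩
      + 28 * ((+ 7 * a * a + + 10 * a + + 3) + (+ 7 * b * b + + 1 * b + + 0)) + + 17
        ≡⟨ cong (λ k → + 28 * k + + 17) (cong₂ _+_ (P-ℤ a) (Q-ℤ b)) ⟨
      + 28 * (+ quadratic 7 10 3 a + + quadratic 7 1 0 b) + + 17
        ≡⟨ cong (λ k → + 28 * k + + 17)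
                (trans (sym (ℤ.pos-+ (quadratic 7 10 3 a) (quadratic 7 1 0 b))) (cong +_ (≡ᵇ-true⇒≡ _ m e))) ⟩
      + 28 * + m + + 17
        ≡⟨ trans (ℤ.pos-+ (28 ℕ.* m) 17) (cong (_+ + 17) (ℤ.pos-* 28 m)) ⟨
      + (28 ℕ.* m ℕ.+ 17)
        ∎)
    where
    open ≡-Reasoning
    x = + 14 * a + + 10
    y = + 14 * b + + 1
    square-abs : ∀ z → + ∣ z ∣ * + ∣ z ∣ ≡ z * z
    square-abs (+ n)    = refl
    square-abs -[1+ n ] = refl
    lemma : ∀ a b → (+ 14 * a + + 10) * (+ 14 * a + + 10) + (+ 14 * b + + 1) * (+ 14 * b + + 1)
                  ≡ + 28 * ((+ 7 * a * a + + 10 * a + + 3) + (+ 7 * b * b + + 1 * b + + 0)) + + 17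
    lemma = solve-∀

module PsiModuloTwo where

  open import Defs
  open import Data.Nat.DivMod using (_/_; _%_; m*n/n≡m)
  open PowerSeries
  open XorSum
  open IntegerParity
  open ThetaSeries
  open QuadraticTheta
  open import Data.Bool.Base using (Bool; true; false; _∧_; _xor_; if_then_else_)
  open import Data.Bool.Properties using (xor-identityʳ)
  open import Data.Integer.Base using (ℤ; +_; -[1+_]; _+_; _*_; ∣_∣; 0ℤ)
  open import Data.List.Base using ([]; _∷_; _∷ʳ_; map; upTo)
  open import Data.List.Properties using (upTo-∷ʳ)
  open import Data.List.Membership.Propositional.Properties using (∈-upTo⁺)
  open import Data.List.Relation.Unary.Unique.Propositional.Properties using (upTo⁺)
  open import Data.Nat.Base as ℕ using (ℕ; zero; suc; _≡ᵇ_; _≤_; s≤s)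
  import Data.Nat.Properties as ℕ
  import Data.Nat.Tactic.RingSolver as ℕ-Solver
  open import Function.Base using (_∘_)
  open import Relation.Binary.PropositionalEquality

  triangular : ℕ → ℕ
  triangular zero    = 0
  triangular (suc n) = triangular n ℕ.+ suc n

  2*tri : ∀ n → 2 ℕ.* tri n ≡ n ℕ.* suc n
  2*tri n = begin
    2 ℕ.* tri n                     ≡⟨ cong (λ k → 2 ℕ.* (k / 2)) (twice-triangular n) ⟩
    2 ℕ.* (triangular n ℕ.* 2 / 2)  ≡⟨ cong (2 ℕ.*_) (m*n/n≡m (triangular n) 2) ⟩
    2 ℕ.* triangular n              ≡⟨ ℕ.*-comm 2 (triangular n) ⟩
    triangular n ℕ.* 2              ≡⟨ twice-triangular n ⟨
    n ℕ.* suc n                     ∎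
    where
    open ≡-Reasoning
    twice-triangular : ∀ n → n ℕ.* suc n ≡ triangular n ℕ.* 2
    twice-triangular zero    = refl
    twice-triangular (suc n) = trans (lemma n) (trans (cong (ℕ._+ 2 ℕ.* suc n) (twice-triangular n)) (lemma′ (triangular n) n))
      where
      lemma : ∀ n → suc n ℕ.* suc (suc n) ≡ n ℕ.* suc n ℕ.+ 2 ℕ.* suc n
      lemma = ℕ-Solver.solve-∀
      lemma′ : ∀ t n → t ℕ.* 2 ℕ.+ 2 ℕ.* suc n ≡ (t ℕ.+ suc n) ℕ.* 2
      lemma′ = ℕ-Solver.solve-∀

  psi-exponent : ∀ m n → 2 ℕ.* (9 ℕ.* tri m ℕ.+ 5 ℕ.* tri n) ≡ 9 ℕ.* (m ℕ.* suc m) ℕ.+ 5 ℕ.* (n ℕ.* suc n)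
  psi-exponent m n = trans (lemma (tri m) (tri n)) (cong₂ (λ x y → 9 ℕ.* x ℕ.+ 5 ℕ.* y) (2*tri m) (2*tri n))
    where
    lemma : ∀ x y → 2 ℕ.* (9 ℕ.* x ℕ.+ 5 ℕ.* y) ≡ 9 ℕ.* (2 ℕ.* x) ℕ.+ 5 ℕ.* (2 ℕ.* y)
    lemma = ℕ-Solver.solve-∀

  psi-exponent-nonneg : ∀ n → 9 ℕ.* tri n ℕ.+ 5 ℕ.* tri (n ℕ.∸ 1) ≡ quadratic 7 2 0 (+ n)
  psi-exponent-nonneg zero    = refl
  psi-exponent-nonneg (suc k) = ℕ.*-cancelˡ-≡ _ _ 2 (trans (psi-exponent (suc k) k) (lemma k))
    where
    lemma : ∀ k → 9 ℕ.* (suc k ℕ.* suc (suc k)) ℕ.+ 5 ℕ.* (k ℕ.* suc k)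
                ≡ 2 ℕ.* (7 ℕ.* suc k ℕ.* suc k ℕ.+ 2 ℕ.* suc k ℕ.+ 0)
    lemma = ℕ-Solver.solve-∀

  psi-exponent-neg : ∀ k → 9 ℕ.* tri k ℕ.+ 5 ℕ.* tri (suc k) ≡ quadratic 7 2 0 -[1+ k ]
  psi-exponent-neg k = ℕ.*-cancelˡ-≡ _ _ 2 (trans (psi-exponent k (suc k)) (lemma k))
    where
    lemma : ∀ k → 9 ℕ.* (k ℕ.* suc k) ℕ.+ 5 ℕ.* (suc k ℕ.* suc (suc k))
                ≡ 2 ℕ.* (7 ℕ.* k ℕ.* k ℕ.+ 12 ℕ.* k ℕ.+ 5)
    lemma = ℕ-Solver.solve-∀

  F-exponent-≥ : ∀ x → ∣ x ∣ ≤ quadratic 7 2 0 x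
  F-exponent-≥ (+ n)    = ℕ.≤-trans (ℕ.m≤n*m n 2) (ℕ.≤-trans (ℕ.m≤n+m (2 ℕ.* n) (7 ℕ.* n ℕ.* n)) (ℕ.m≤m+n _ 0))
  F-exponent-≥ -[1+ k ] = subst (suc k ≤_) (lemma k) (ℕ.m≤m+n (suc k) (7 ℕ.* k ℕ.* k ℕ.+ 11 ℕ.* k ℕ.+ 4))
    where
    lemma : ∀ k → suc k ℕ.+ (7 ℕ.* k ℕ.* k ℕ.+ 11 ℕ.* k ℕ.+ 4) ≡ 7 ℕ.* k ℕ.* k ℕ.+ 12 ℕ.* k ℕ.+ 5
    lemma = ℕ-Solver.solve-∀

  parity-sumTo : ∀ N f → parity (sumTo N f) ≡ ⨁[ j ∈ upTo (suc N) ] parity (f j)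
  parity-sumTo zero    f = sym (xor-identityʳ (parity (f 0)))
  parity-sumTo (suc N) f = begin
    parity (sumTo N f + f (suc N))                          ≡⟨ parity-+ (sumTo N f) (f (suc N)) ⟩
    parity (sumTo N f) xor parity (f (suc N))
                                                    ≡⟨ cong₂ _xor_ (parity-sumTo N f) (sym (xor-identityʳ (parity (f (suc N))))) ⟩
    ⨁ (upTo (suc N)) (parity ∘ f) xor ⨁ (suc N ∷ []) (parity ∘ f)
                                                            ≡⟨ ⨁-++ (upTo (suc N)) (suc N ∷ []) (parity ∘ f) ⟨
    ⨁ (upTo (suc N) ∷ʳ suc N) (parity ∘ f)                  ≡⟨ cong (λ is → ⨁ is (parity ∘ f)) (upTo-∷ʳ (suc N)) ⟩
    ⨁ (upTo (suc (suc N))) (parity ∘ f)                     ∎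
    where open ≡-Reasoning

  parity-sgn : ∀ e → parity (sgn e) ≡ true
  parity-sgn e with e % 2 ≡ᵇ 0
  ... | true  = refl
  ... | false = refl

  parity-ind : ∀ a b → parity (ind a b) ≡ (a ≡ᵇ b)
  parity-ind a b with a ≡ᵇ b
  ... | true  = refl
  ... | false = refl

  parity-psi-term : ∀ e a N → parity (sgn e * ind a N) ≡ (a ≡ᵇ N)
  parity-psi-term e a N = trans (parity-* (sgn e) (ind a N)) (cong₂ _∧_ (parity-sgn e) (parity-ind a N))

  parity-psiCoeff : ∀ N → parity (psiCoeff 9 5 N) ≡ F N
  parity-psiCoeff N = begin
    parity (psiCoeff 9 5 N)
      ≡⟨ parity-difference (sumTo N f₊) (sumTo N f₋) ⟩
    parity (sumTo N f₊) xor parity (sumTo N f₋)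
      ≡⟨ cong₂ _xor_ (trans (parity-sumTo N f₊) (⨁-cong (upTo (suc N)) (λ {n} _ → nonneg-term n)))
                     (trans (parity-sumTo N f₋)
                            (trans (⨁-upTo-suc N (parity ∘ f₋)) (⨁-cong (upTo N) (λ {k} _ → neg-term k)))) ⟩
    ⨁[ n ∈ upTo (suc N) ] g (+ n) xor ⨁[ k ∈ upTo N ] g -[1+ k ]
      ≡⟨ cong₂ _xor_
           (⨁-support ℕ._≟_ (upTo⁺ (suc N)) (upTo⁺ (2 ℕ.+ N)) (nonneg-support ℕ.≤-refl) (nonneg-support (ℕ.n≤1+n _)))
           (⨁-support ℕ._≟_ (upTo⁺ N) (upTo⁺ (2 ℕ.+ N)) (neg-support ℕ.≤-refl) (neg-support (ℕ.m≤n+m N 2))) ⟩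
    ⨁[ n ∈ upTo (2 ℕ.+ N) ] g (+ n) xor ⨁[ k ∈ upTo (2 ℕ.+ N) ] g -[1+ k ]
      ≡⟨ cong₂ _xor_ (⨁-map +_ (upTo (2 ℕ.+ N)) g) (⨁-map -[1+_] (upTo (2 ℕ.+ N)) g) ⟨
    ⨁ (map +_ (upTo (2 ℕ.+ N))) g xor ⨁ (map -[1+_] (upTo (2 ℕ.+ N))) g
      ≡⟨ ⨁-++ (map +_ (upTo (2 ℕ.+ N))) (map -[1+_] (upTo (2 ℕ.+ N))) g ⟨
    F N
      ∎
    where
    open ≡-Reasoning
    f₊ f₋ : ℕ → ℤ
    f₊ n = sgn (tri n) * ind (9 ℕ.* tri n ℕ.+ 5 ℕ.* tri (n ℕ.∸ 1)) N
    f₋ m = if m ≡ᵇ 0 then 0ℤ else sgn (tri (m ℕ.∸ 1)) * ind (9 ℕ.* tri (m ℕ.∸ 1) ℕ.+ 5 ℕ.* tri m) N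
    g : ℤ → Bool
    g x = quadratic 7 2 0 x ≡ᵇ N
    nonneg-term : ∀ n → parity (f₊ n) ≡ g (+ n)
    nonneg-term n = trans (parity-psi-term (tri n) (9 ℕ.* tri n ℕ.+ 5 ℕ.* tri (n ℕ.∸ 1)) N)
                          (cong (ℕ._≡ᵇ N) (psi-exponent-nonneg n))
    neg-term : ∀ k → parity (f₋ (suc k)) ≡ g -[1+ k ]
    neg-term k = trans (parity-psi-term (tri k) (9 ℕ.* tri k ℕ.+ 5 ℕ.* tri (suc k)) N)
                       (cong (ℕ._≡ᵇ N) (psi-exponent-neg k))
    nonneg-support : ∀ {B} → suc N ≤ B → Supported (upTo B) (g ∘ +_)
    nonneg-support N<B {n} e = ∈-upTo⁺ (ℕ.<-≤-trans (s≤s (subst (n ≤_) (≡ᵇ-true⇒≡ _ N e) (F-exponent-≥ (+ n)))) N<B)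
    neg-support : ∀ {B} → N ≤ B → Supported (upTo B) (g ∘ -[1+_])
    neg-support N≤B {k} e = ∈-upTo⁺ (ℕ.<-≤-trans (subst (suc k ≤_) (≡ᵇ-true⇒≡ _ N e) (F-exponent-≥ -[1+ k ])) N≤B)

  F-reciprocal : ∀ c → IsReciprocalCoeffs 9 5 c → (parity ∘ c) · F ≗ 1ₛ
  F-reciprocal c c·Ψ≡1 N = begin
    ((parity ∘ c) · F) N
      ≡⟨ ·-as-⨁ (parity ∘ c) F N ⟩
    ⨁[ j ∈ upTo (suc N) ] (parity (c j) ∧ F (N ℕ.∸ j))
      ≡⟨ ⨁-cong (upTo (suc N)) (λ {j} _ → sym (trans (parity-* (c j) (psiCoeff 9 5 (N ℕ.∸ j)))
                                                       (cong (parity (c j) ∧_) (parity-psiCoeff (N ℕ.∸ j))))) ⟩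
    ⨁[ j ∈ upTo (suc N) ] parity (c j * psiCoeff 9 5 (N ℕ.∸ j))
      ≡⟨ parity-sumTo N (λ j → c j * psiCoeff 9 5 (N ℕ.∸ j)) ⟨
    parity (sumTo N (λ j → c j * psiCoeff 9 5 (N ℕ.∸ j)))
      ≡⟨ cong parity (c·Ψ≡1 N) ⟩
    parity (ind N 0)
      ≡⟨ parity-ind N 0 ⟩
    (N ≡ᵇ 0)
      ≡⟨ unit N ⟩
    1ₛ N
      ∎
    where
    open ≡-Reasoning
    unit : ∀ N → (N ≡ᵇ 0) ≡ 1ₛ N
    unit zero    = refl
    unit (suc N) = refl

module SumsOfTwoSquares where

  open import Data.Nat.Base
  open import Data.Nat.Properties
  open import Data.Nat.Divisibility
    using (_∣_; divides; ∣-reflexive; ∣-trans; _∣0; ∣m∣n⇒∣m+n; ∣m+n∣m⇒∣n; m∣m*n; ∣m⇒∣m*n; ∣n⇒∣m*n; ∣⇒≤)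
  open import Data.Nat.DivMod using (_/_; _%_; m≡m%n+[m/n]*n)
  open import Data.Nat.Primality using (Prime; euclidsLemma; prime⇒nonZero)
  open import Data.Nat.Combinatorics using (_C_; nCk+nC[k+1]≡[n+1]C[k+1]; nCn≡1; nC1≡n)
  open import Data.Nat.Combinatorics.Specification using (k>n⇒nCk≡0)
  import Data.Nat.Tactic.RingSolver as ℕ-Solver
  open import Data.Product.Base using (∃-syntax; _×_; _,_)
  open import Data.Sum.Base using (inj₁; inj₂; [_,_]′)
  open import Function.Base using (_∘_)
  open import Relation.Binary.PropositionalEquality
  open import Relation.Nullary.Negation using (¬_; contradiction)

  polynomial : (ℕ → ℕ) → ℕ → ℕ → ℕ
  polynomial c zero    a = 0
  polynomial c (suc n) a = c 0 + a * polynomial (c ∘ suc) n a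

  polynomial-+ : ∀ c d n a → polynomial (λ k → c k + d k) n a ≡ polynomial c n a + polynomial d n a
  polynomial-+ c d zero    a = refl
  polynomial-+ c d (suc n) a = trans (cong (λ x → c 0 + d 0 + a * x) (polynomial-+ (c ∘ suc) (d ∘ suc) n a))
                                     (lemma (c 0) (d 0) a _ _)
    where
    lemma : ∀ x y a u v → x + y + a * (u + v) ≡ x + a * u + (y + a * v)
    lemma = ℕ-Solver.solve-∀

  polynomial-last : ∀ c n a → polynomial c (suc n) a ≡ polynomial c n a + c n * a ^ n
  polynomial-last c zero    a = lemma (c 0) a
    where
    lemma : ∀ x a → x + a * 0 ≡ 0 + x * 1
    lemma = ℕ-Solver.solve-∀
  polynomial-last c (suc n) a = trans (cong (λ x → c 0 + a * x) (polynomial-last (c ∘ suc) n a))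
                                      (lemma (c 0) a _ (c (suc n)) (a ^ n))
    where
    lemma : ∀ x a u y w → x + a * (u + y * w) ≡ x + a * u + y * (a * w)
    lemma = ℕ-Solver.solve-∀

  polynomial-∣ : ∀ {p} c n a → (∀ k → k < n → p ∣ c k) → p ∣ polynomial c n a
  polynomial-∣ c zero    a p∣c = _ ∣0
  polynomial-∣ c (suc n) a p∣c =
    ∣m∣n⇒∣m+n (p∣c 0 z<s) (∣n⇒∣m*n a (polynomial-∣ (c ∘ suc) n a (λ k k<n → p∣c (suc k) (s<s k<n))))

  [k+1]*[n+1]C[k+1]≡[n+1]*nCk : ∀ n k → suc k * (suc n C suc k) ≡ suc n * (n C k)
  [k+1]*[n+1]C[k+1]≡[n+1]*nCk zero    zero    = refl
  [k+1]*[n+1]C[k+1]≡[n+1]*nCk zero    (suc k) = *-zeroʳ (suc (suc k))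
  [k+1]*[n+1]C[k+1]≡[n+1]*nCk (suc n) zero    =
    trans (+-identityʳ (suc (suc n) C 1)) (trans (nC1≡n (suc (suc n))) (sym (*-identityʳ (suc (suc n)))))
  [k+1]*[n+1]C[k+1]≡[n+1]*nCk (suc n) (suc k) = begin
    suc (suc k) * (suc (suc n) C suc (suc k))
      ≡⟨ cong (suc (suc k) *_) (nCk+nC[k+1]≡[n+1]C[k+1] (suc n) (suc k)) ⟨
    suc (suc k) * (suc n C suc k + suc n C suc (suc k))
      ≡⟨ lemma k (suc n C suc k) (suc n C suc (suc k)) ⟩
    suc k * (suc n C suc k) + suc n C suc k + suc (suc k) * (suc n C suc (suc k))
      ≡⟨ cong₂ (λ x y → x + suc n C suc k + y) ([k+1]*[n+1]C[k+1]≡[n+1]*nCk n k) ([k+1]*[n+1]C[k+1]≡[n+1]*nCk n (suc k)) ⟩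
    suc n * (n C k) + suc n C suc k + suc n * (n C suc k)
      ≡⟨ lemma′ n (n C k) (suc n C suc k) (n C suc k) ⟩
    suc n * (n C k + n C suc k) + suc n C suc k
      ≡⟨ cong (λ x → suc n * x + suc n C suc k) (nCk+nC[k+1]≡[n+1]C[k+1] n k) ⟩
    suc n * (suc n C suc k) + suc n C suc k
      ≡⟨ lemma″ n (suc n C suc k) ⟩
    suc (suc n) * (suc n C suc k)
      ∎
    where
    open ≡-Reasoning
    lemma : ∀ k x y → suc (suc k) * (x + y) ≡ suc k * x + x + suc (suc k) * y
    lemma = ℕ-Solver.solve-∀
    lemma′ : ∀ n x y z → suc n * x + y + suc n * z ≡ suc n * (x + z) + y
    lemma′ = ℕ-Solver.solve-∀
    lemma″ : ∀ n x → suc n * x + x ≡ suc (suc n) * x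
    lemma″ = ℕ-Solver.solve-∀

  polynomial-cong : ∀ {c d} n a → (∀ k → c k ≡ d k) → polynomial c n a ≡ polynomial d n a
  polynomial-cong zero    a c≗d = refl
  polynomial-cong (suc n) a c≗d = cong₂ (λ x y → x + a * y) (c≗d 0) (polynomial-cong n a (c≗d ∘ suc))

  binomial-expansion : ∀ n a → (1 + a) ^ n ≡ polynomial (n C_) (suc n) a
  binomial-expansion zero    a = sym (cong suc (*-zeroʳ a))
  binomial-expansion (suc n) a = begin
    (1 + a) * (1 + a) ^ n
      ≡⟨ cong ((1 + a) *_) (binomial-expansion n a) ⟩
    (1 + a) * (1 + a * H′)
      ≡⟨ lemma a H′ ⟩
    1 + a * ((1 + a * H′) + H′)
      ≡⟨ cong (λ x → 1 + a * ((1 + a * H′) + x)) H′-extended ⟨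
    1 + a * (polynomial (n C_) (suc n) a + polynomial (λ k → n C suc k) (suc n) a)
      ≡⟨ cong (λ x → 1 + a * x) (polynomial-+ (n C_) (λ k → n C suc k) (suc n) a) ⟨
    1 + a * polynomial (λ k → n C k + n C suc k) (suc n) a
      ≡⟨ cong (λ x → 1 + a * x) (polynomial-cong (suc n) a (nCk+nC[k+1]≡[n+1]C[k+1] n)) ⟩
    polynomial (suc n C_) (suc (suc n)) a
      ∎
    where
    open ≡-Reasoning
    H′ = polynomial (λ k → n C suc k) n a
    H′-extended : polynomial (λ k → n C suc k) (suc n) a ≡ H′
    H′-extended = trans (polynomial-last (λ k → n C suc k) n a)
      (trans (cong (λ x → H′ + x * a ^ n) (k>n⇒nCk≡0 (n<1+n n))) (+-identityʳ H′))
    lemma : ∀ a h → (1 + a) * (1 + a * h) ≡ 1 + a * ((1 + a * h) + h)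
    lemma = ℕ-Solver.solve-∀

  p∣pCk : ∀ {p k} → Prime p → 0 < k → k < p → p ∣ p C k
  p∣pCk {suc m} {suc k} p-prime _ k<p
    with euclidsLemma (suc k) (suc m C suc k) p-prime (divides (m C k) (trans ([k+1]*[n+1]C[k+1]≡[n+1]*nCk m k) (*-comm (suc m) (m C k))))
  ... | inj₁ p∣1+k = contradiction (∣⇒≤ p∣1+k) (<⇒≱ k<p)
  ... | inj₂ p∣pCk = p∣pCk

  freshmans-dream : ∀ {p} → Prime p → ∀ a → ∃[ K ] (1 + a) ^ p ≡ 1 + a ^ p + p * K
  freshmans-dream {suc m} p-prime a
    with divides d middle≡ ← polynomial-∣ (λ k → suc m C suc k) m a (λ k k<m → p∣pCk p-prime z<s (s<s k<m))
    = a * d , (begin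
      (1 + a) ^ suc m                                                  ≡⟨ binomial-expansion (suc m) a ⟩
      1 + a * polynomial (λ k → suc m C suc k) (suc m) a               ≡⟨ cong (λ x → 1 + a * x) (polynomial-last (λ k → suc m C suc k) m a) ⟩
      1 + a * (polynomial (λ k → suc m C suc k) m a + (suc m C suc m) * a ^ m)
                                                                       ≡⟨ cong₂ (λ x y → 1 + a * (x + y * a ^ m)) middle≡ (nCn≡1 (suc m)) ⟩
      1 + a * (d * suc m + 1 * a ^ m)                                  ≡⟨ lemma a d m (a ^ m) ⟩
      1 + a * a ^ m + suc m * (a * d)                                  ∎)
    where
    open ≡-Reasoning
    lemma : ∀ a d m w → 1 + a * (d * suc m + 1 * w) ≡ 1 + a * w + suc m * (a * d)
    lemma = ℕ-Solver.solve-∀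

  fermats-little-theorem : ∀ {p} → Prime p → ∀ a → ∃[ K ] a ^ p ≡ a + p * K
  fermats-little-theorem {suc m} p-prime zero    = 0 , sym (*-zeroʳ (suc m))
  fermats-little-theorem {suc m} p-prime (suc a)
    with K₀ , a^p≡ ← fermats-little-theorem p-prime a | K₁ , [1+a]^p≡ ← freshmans-dream p-prime a
    = K₀ + K₁ , trans [1+a]^p≡ (trans (cong (λ x → 1 + x + suc m * K₁) a^p≡) (lemma a (suc m) K₀ K₁))
    where
    lemma : ∀ a p K₀ K₁ → 1 + (a + p * K₀) + p * K₁ ≡ suc a + p * (K₀ + K₁)
    lemma = ℕ-Solver.solve-∀

  sum∣odd-power-sum : ∀ a b j → a + b ∣ a ^ suc (2 * j) + b ^ suc (2 * j)
  sum∣odd-power-sum a b zero    = ∣-reflexive (cong₂ _+_ (sym (*-identityʳ a)) (sym (*-identityʳ b)))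
  sum∣odd-power-sum a b (suc j) = ∣m+n∣m⇒∣n step (∣n⇒∣m*n (a * b) (sum∣odd-power-sum a b j))
    where
    A = a ^ (2 * j)
    B = b ^ (2 * j)
    lemma : ∀ a b A B → (a + b) * (a * (a * A) + b * (b * B))
                      ≡ a * b * (a * A + b * B) + (a * (a * (a * A)) + b * (b * (b * B)))
    lemma = ℕ-Solver.solve-∀
    step : a + b ∣ a * b * (a ^ suc (2 * j) + b ^ suc (2 * j)) + (a ^ suc (2 * suc j) + b ^ suc (2 * suc j))
    step = subst (a + b ∣_)
      (trans (lemma a b A B) (cong (λ e → a * b * (a * A + b * B) + (a ^ suc e + b ^ suc e)) (sym (*-suc 2 j))))
      (m∣m*n _)

  module _ {p : ℕ} (p-prime : Prime p) (p%4≡3 : p % 4 ≡ 3) where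

    private
      j n : ℕ
      j = p / 4
      n = suc (2 * j)

      p≡4j+3 : p ≡ 3 + 4 * j
      p≡4j+3 = trans (m≡m%n+[m/n]*n p 4) (trans (cong (_+ j * 4) p%4≡3) (cong (3 +_) (*-comm j 4)))

      p≡2n+1 : p ≡ suc (2 * n)
      p≡2n+1 = trans p≡4j+3 (lemma j)
        where
        lemma : ∀ j → 3 + 4 * j ≡ suc (2 * suc (2 * j))
        lemma = ℕ-Solver.solve-∀

      x^p : ∀ x → x ^ p ≡ x * (x * x) ^ n
      x^p x = begin
        x ^ p                ≡⟨ cong (x ^_) p≡2n+1 ⟩
        x * x ^ (2 * n)      ≡⟨ cong (x *_) (^-*-assoc x 2 n) ⟨
        x * (x ^ 2) ^ n      ≡⟨ cong (λ y → x * y ^ n) (cong (x *_) (*-identityʳ x)) ⟩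
        x * (x * x) ^ n      ∎
        where open ≡-Reasoning

    -- Modulo p, x² ≡ -y² and (p-1)/2 odd give x^(p-1) ≡ -y^(p-1); then Fermat turns
    -- xy (x^(p-1) + y^(p-1)) = y x^p + x y^p into 0 ≡ 2xy.
    ∣-sum-of-squares⇒∣ : ∀ x y → p ∣ x * x + y * y → p ∣ x
    ∣-sum-of-squares⇒∣ x y p∣x²+y² = [ p∣2x⇒p∣x , p∣y⇒p∣x ]′ (euclidsLemma (2 * x) y p-prime p∣2xy)
      where
      X = (x * x) ^ n
      Y = (y * y) ^ n

      p∣2xy : p ∣ 2 * x * y
      p∣2xy with K , x^p≡ ← fermats-little-theorem p-prime x | L , y^p≡ ← fermats-little-theorem p-prime y =
        ∣m+n∣m⇒∣n (subst (p ∣_) expand (∣n⇒∣m*n (x * y) (∣-trans p∣x²+y² (sum∣odd-power-sum (x * x) (y * y) j))))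
                  (m∣m*n (y * K + x * L))
        where
        open ≡-Reasoning
        lemma : ∀ x y X Y → x * y * (X + Y) ≡ y * (x * X) + x * (y * Y)
        lemma = ℕ-Solver.solve-∀
        lemma′ : ∀ x y p K L → y * (x + p * K) + x * (y + p * L) ≡ p * (y * K + x * L) + 2 * x * y
        lemma′ = ℕ-Solver.solve-∀
        expand : x * y * (X + Y) ≡ p * (y * K + x * L) + 2 * x * y
        expand = begin
          x * y * (X + Y)                      ≡⟨ lemma x y X Y ⟩
          y * (x * X) + x * (y * Y)            ≡⟨ cong₂ (λ u v → y * u + x * v) (x^p x) (x^p y) ⟨
          y * x ^ p + x * y ^ p                ≡⟨ cong₂ (λ u v → y * u + x * v) x^p≡ y^p≡ ⟩
          y * (x + p * K) + x * (y + p * L)    ≡⟨ lemma′ x y p K L ⟩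
          p * (y * K + x * L) + 2 * x * y      ∎

      p∣2x⇒p∣x : p ∣ 2 * x → p ∣ x
      p∣2x⇒p∣x p∣2x =
        [ (λ p∣2 → contradiction (∣⇒≤ p∣2) (<⇒≱ 2<p)) , (λ p∣x → p∣x) ]′ (euclidsLemma 2 x p-prime p∣2x)
        where
        2<p : 2 < p
        2<p = subst (2 <_) (sym p≡4j+3) (s≤s (s≤s (s≤s z≤n)))

      p∣y⇒p∣x : p ∣ y → p ∣ x
      p∣y⇒p∣x p∣y = [ (λ p∣x → p∣x) , (λ p∣x → p∣x) ]′
        (euclidsLemma x x p-prime (∣m+n∣m⇒∣n (subst (p ∣_) (+-comm (x * x) (y * y)) p∣x²+y²) (∣m⇒∣m*n y p∣y)))

    private
      instance
        p≢0 : NonZero p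
        p≢0 = prime⇒nonZero p-prime

      ∣-sum-of-squares⇒∣-both : ∀ x y → p ∣ x * x + y * y → p ∣ x × p ∣ y
      ∣-sum-of-squares⇒∣-both x y p∣x²+y² =
        ∣-sum-of-squares⇒∣ x y p∣x²+y² , ∣-sum-of-squares⇒∣ y x (subst (p ∣_) (+-comm (x * x) (y * y)) p∣x²+y²)

      p∣p^odd* : ∀ k M → p ∣ p ^ (2 * k + 1) * M
      p∣p^odd* k M = ∣m⇒∣m*n M (subst (λ e → p ∣ p ^ e) (+-comm 1 (2 * k)) (m∣m*n (p ^ (2 * k))))

    -- Descent: dividing x and y by p lowers the exponent of p by two.
    sum-of-squares≢p^odd : ∀ k x y M → ¬ p ∣ M → x * x + y * y ≢ p ^ (2 * k + 1) * M
    sum-of-squares≢p^odd k x y M p∤M eq with ∣-sum-of-squares⇒∣-both x y (subst (p ∣_) (sym eq) (p∣p^odd* k M))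
    sum-of-squares≢p^odd zero x y M p∤M eq | divides x′ refl , divides y′ refl =
      p∤M (divides (x′ * x′ + y′ * y′) (*-cancelʳ-≡ M ((x′ * x′ + y′ * y′) * p) p (begin
        M * p                                    ≡⟨ lemma p M ⟩
        p ^ (2 * 0 + 1) * M                      ≡⟨ eq ⟨
        x′ * p * (x′ * p) + y′ * p * (y′ * p)    ≡⟨ lemma′ x′ y′ p ⟩
        (x′ * x′ + y′ * y′) * p * p              ∎)))
      where
      open ≡-Reasoning
      lemma : ∀ p M → M * p ≡ p * 1 * M
      lemma = ℕ-Solver.solve-∀
      lemma′ : ∀ a b p → a * p * (a * p) + b * p * (b * p) ≡ (a * a + b * b) * p * p
      lemma′ = ℕ-Solver.solve-∀
    sum-of-squares≢p^odd (suc k) x y M p∤M eq | divides x′ refl , divides y′ refl =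
      sum-of-squares≢p^odd k x′ y′ M p∤M (*-cancelʳ-≡ _ _ (p * p) {{m*n≢0 p p}} (begin
        (x′ * x′ + y′ * y′) * (p * p)            ≡⟨ lemma x′ y′ p ⟩
        x′ * p * (x′ * p) + y′ * p * (y′ * p)    ≡⟨ eq ⟩
        p ^ (2 * suc k + 1) * M                  ≡⟨ cong (λ e → p ^ e * M) (lemma′ k) ⟩
        p * (p * p ^ (2 * k + 1)) * M            ≡⟨ lemma″ p (p ^ (2 * k + 1)) M ⟩
        p ^ (2 * k + 1) * M * (p * p)            ∎))
      where
      open ≡-Reasoning
      lemma : ∀ a b p → (a * a + b * b) * (p * p) ≡ a * p * (a * p) + b * p * (b * p)
      lemma = ℕ-Solver.solve-∀
      lemma′ : ∀ k → 2 * suc k + 1 ≡ suc (suc (2 * k + 1))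
      lemma′ = ℕ-Solver.solve-∀
      lemma″ : ∀ p q M → p * (p * q) * M ≡ q * M * (p * p)
      lemma″ = ℕ-Solver.solve-∀

open import Defs
open PowerSeries
open IntegerParity
open QuadraticTheta
open PsiModuloTwo
open SumsOfTwoSquares
open import Data.Nat.Base using (ℕ; zero; suc; _+_; _*_; _^_; _<_)
open import Data.Nat.DivMod using (_/_; _%_; m≡m%n+[m/n]*n; m*n/n≡m; [m+kn]%n≡m%n)
open import Data.Nat.Primality using (Prime; euclidsLemma)
open import Data.Nat.Divisibility as ℕD using (_∣?_; ∣⇒≤; ∣m+n∣m⇒∣n; n∣m*n)
open import Data.Nat.Properties using (+-identityʳ; +-comm; +-suc; *-zeroʳ; *-identityʳ; ^-*-assoc; <⇒≱; m≤m+n)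
import Data.Nat.Tactic.RingSolver as ℕ-Solver
open import Data.Integer.Base using (ℤ; +_)
open import Data.Integer.Divisibility using (_∣_)
open import Data.Bool.Base using (false)
open import Data.Bool.Properties using (¬-not)
open import Data.Product.Base using (_×_; _,_; ∃-syntax)
open import Data.Sum.Base using (_⊎_; inj₁; inj₂; [_,_]′)
open import Function.Base using (_∘_)
open import Relation.Nullary.Decidable using (from-no)
open import Relation.Nullary.Negation using (¬_)
open import Relation.Binary.PropositionalEquality

parity-c[8m+5]≡P·Q : ∀ c → IsReciprocalCoeffs 9 5 c → ∀ m → parity (c (8 * m + 5)) ≡ (P · Q) m
parity-c[8m+5]≡P·Q c c-reciprocal m = trans (cong (parity ∘ c) (8m+5≡ m))
  (reciprocal-8m+5 (F-reciprocal c c-reciprocal) evenPart-F oddPart-F oddPart-R·F m)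
  where
  8m+5≡ : ∀ m → 8 * m + 5 ≡ suc (double (double (suc (double m))))
  8m+5≡ m = begin
    8 * m + 5                               ≡⟨ lemma m ⟩
    suc (2 * (2 * suc (2 * m)))             ≡⟨ cong (λ x → suc (2 * (2 * suc x))) (double≡2* m) ⟨
    suc (2 * (2 * suc (double m)))          ≡⟨ cong (λ x → suc (2 * x)) (double≡2* (suc (double m))) ⟨
    suc (2 * double (suc (double m)))       ≡⟨ cong suc (double≡2* (double (suc (double m)))) ⟨
    suc (double (double (suc (double m))))  ∎
    where
    open ≡-Reasoning
    lemma : ∀ m → 8 * m + 5 ≡ suc (2 * (2 * suc (2 * m)))
    lemma = ℕ-Solver.solve-∀

P·Q-vanishes : ∀ {p} k m M → Prime p → p % 4 ≡ 3 → ¬ p ℕD.∣ M →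
  28 * m + 17 ≡ p ^ (2 * k + 1) * M → (P · Q) m ≡ false
P·Q-vanishes k m M p-prime p%4≡3 p∤M 28m+17≡ = ¬-not λ P·Q≡true →
  let x , y , x²+y²≡ = P·Q≡true⇒sum-of-two-squares m P·Q≡true
  in  sum-of-squares≢p^odd p-prime p%4≡3 k x y M p∤M (trans x²+y²≡ 28m+17≡)

-- The residues 15 and 27 are 3 + 4i with i = 3, 6, and their squares are 1 + 56s with s = 4, 13.
residue-mod-28 : ∀ {p i s} → p % 28 ≡ 3 + 4 * i → (3 + 4 * i) * (3 + 4 * i) ≡ 1 + 56 * s → ¬ (3 + 4 * i) ℕD.∣ 28 →
  p % 4 ≡ 3 × (∃[ t ] p * p ≡ 1 + 56 * t) × ¬ p ℕD.∣ 28
residue-mod-28 {p} {i} {s} p%28≡r r²≡ r∤28 =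
  trans (cong (_% 4) (trans p≡ (lemma₁ i q))) ([m+kn]%n≡m%n 3 (i + 7 * q) 4) ,
  (s + r * q + 14 * q * q ,
   trans (cong₂ _*_ p≡ p≡) (trans (lemma₂ r q) (trans (cong (_+ 56 * (r * q + 14 * q * q)) r²≡) (lemma₃ s r q)))) ,
  p∤28 q p≡
  where
  r = 3 + 4 * i
  q = p / 28
  p≡ : p ≡ r + q * 28
  p≡ = trans (m≡m%n+[m/n]*n p 28) (cong (_+ q * 28) p%28≡r)
  lemma₁ : ∀ i q → 3 + 4 * i + q * 28 ≡ 3 + (i + 7 * q) * 4
  lemma₁ = ℕ-Solver.solve-∀
  lemma₂ : ∀ r q → (r + q * 28) * (r + q * 28) ≡ r * r + 56 * (r * q + 14 * q * q)
  lemma₂ = ℕ-Solver.solve-∀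
  lemma₃ : ∀ s r q → 1 + 56 * s + 56 * (r * q + 14 * q * q) ≡ 1 + 56 * (s + r * q + 14 * q * q)
  lemma₃ = ℕ-Solver.solve-∀
  p∤28 : ∀ q → p ≡ r + q * 28 → ¬ p ℕD.∣ 28
  p∤28 zero    p≡r     p∣28 = r∤28 (subst (ℕD._∣ 28) (trans p≡r (+-identityʳ r)) p∣28)
  p∤28 (suc q) p≡r+28q p∣28 = <⇒≱ 28<p (∣⇒≤ p∣28)
    where
    lemma : ∀ i q → 3 + 4 * i + suc q * 28 ≡ 29 + (2 + 4 * i + q * 28)
    lemma = ℕ-Solver.solve-∀
    28<p : 28 < p
    28<p = subst (28 <_) (sym (trans p≡r+28q (lemma i q))) (m≤m+n 29 _)

15-or-27-mod-28 : ∀ {p} → p % 28 ≡ 15 ⊎ p % 28 ≡ 27 →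
  p % 4 ≡ 3 × (∃[ t ] p * p ≡ 1 + 56 * t) × ¬ p ℕD.∣ 28
15-or-27-mod-28 (inj₁ p%28≡15) = residue-mod-28 {i = 3} {s = 4} p%28≡15 refl (from-no (15 ℕD.∣? 28))
15-or-27-mod-28 (inj₂ p%28≡27) = residue-mod-28 {i = 6} {s = 13} p%28≡27 refl (from-no (27 ℕD.∣? 28))

power≡1-mod : ∀ {a} d {t} → a ≡ 1 + d * t → ∀ k → ∃[ t′ ] a ^ k ≡ 1 + d * t′
power≡1-mod         d a≡ zero    = 0 , sym (cong suc (*-zeroʳ d))
power≡1-mod {a} d {t} a≡ (suc k) with t′ , aᵏ≡ ← power≡1-mod d a≡ k =
  t + t′ + d * t * t′ , trans (cong₂ _*_ a≡ aᵏ≡) (lemma d t t′)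
  where
  lemma : ∀ d t t′ → (1 + d * t) * (1 + d * t′) ≡ 1 + d * (t + t′ + d * t * t′)
  lemma = ℕ-Solver.solve-∀

m^[2k+2]≡[m*m]^[1+k] : ∀ m k → m ^ (2 * k + 2) ≡ (m * m) ^ suc k
m^[2k+2]≡[m*m]^[1+k] m k = begin
  m ^ (2 * k + 2)      ≡⟨ cong (m ^_) (lemma k) ⟩
  m ^ (2 * suc k)      ≡⟨ ^-*-assoc m 2 (suc k) ⟨
  (m ^ 2) ^ suc k      ≡⟨ cong (λ x → (m * x) ^ suc k) (*-identityʳ m) ⟩
  (m * m) ^ suc k      ∎
  where
  open ≡-Reasoning
  lemma : ∀ k → 2 * k + 2 ≡ 2 * suc k
  lemma = ℕ-Solver.solve-∀

module _ (p k n t : ℕ) (p²ᵏ⁺²≡ : p ^ (2 * k + 2) ≡ 1 + 56 * t) where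

  index≡8m+5 : 8 * p ^ (2 * k + 1) * n + (34 * p ^ (2 * k + 2) + 1) / 7 ≡ 8 * (p ^ (2 * k + 1) * n + 34 * t) + 5
  index≡8m+5 = begin
    8 * p ^ (2 * k + 1) * n + (34 * p ^ (2 * k + 2) + 1) / 7  ≡⟨ cong (λ x → 8 * p ^ (2 * k + 1) * n + (34 * x + 1) / 7) p²ᵏ⁺²≡ ⟩
    8 * p ^ (2 * k + 1) * n + (34 * (1 + 56 * t) + 1) / 7     ≡⟨ cong (λ x → 8 * p ^ (2 * k + 1) * n + x / 7) (lemma t) ⟩
    8 * p ^ (2 * k + 1) * n + (5 + 272 * t) * 7 / 7           ≡⟨ cong (λ x → 8 * p ^ (2 * k + 1) * n + x) (m*n/n≡m (5 + 272 * t) 7) ⟩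
    8 * p ^ (2 * k + 1) * n + (5 + 272 * t)                   ≡⟨ lemma′ (p ^ (2 * k + 1)) n t ⟩
    8 * (p ^ (2 * k + 1) * n + 34 * t) + 5                    ∎
    where
    open ≡-Reasoning
    lemma : ∀ t → 34 * (1 + 56 * t) + 1 ≡ (5 + 272 * t) * 7
    lemma = ℕ-Solver.solve-∀
    lemma′ : ∀ P n t → 8 * P * n + (5 + 272 * t) ≡ 8 * (P * n + 34 * t) + 5
    lemma′ = ℕ-Solver.solve-∀

  28m+17≡ : 28 * (p ^ (2 * k + 1) * n + 34 * t) + 17 ≡ p ^ (2 * k + 1) * (28 * n + 17 * p)
  28m+17≡ = begin
    28 * (p ^ (2 * k + 1) * n + 34 * t) + 17       ≡⟨ lemma (p ^ (2 * k + 1)) n t ⟩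
    28 * p ^ (2 * k + 1) * n + 17 * (1 + 56 * t)   ≡⟨ cong (λ x → 28 * p ^ (2 * k + 1) * n + 17 * x) p²ᵏ⁺²≡ ⟨
    28 * p ^ (2 * k + 1) * n + 17 * p ^ (2 * k + 2) ≡⟨ cong (λ e → 28 * p ^ (2 * k + 1) * n + 17 * p ^ e) (+-suc (2 * k) 1) ⟩
    28 * p ^ (2 * k + 1) * n + 17 * (p * p ^ (2 * k + 1)) ≡⟨ lemma′ p (p ^ (2 * k + 1)) n ⟩
    p ^ (2 * k + 1) * (28 * n + 17 * p)            ∎
    where
    open ≡-Reasoning
    lemma : ∀ P n t → 28 * (P * n + 34 * t) + 17 ≡ 28 * P * n + 17 * (1 + 56 * t)
    lemma = ℕ-Solver.solve-∀
    lemma′ : ∀ p P n → 28 * P * n + 17 * (p * P) ≡ P * (28 * n + 17 * p)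
    lemma′ = ℕ-Solver.solve-∀

∤28n+17p : ∀ {p n} → Prime p → ¬ p ℕD.∣ 28 → ¬ p ℕD.∣ n → ¬ p ℕD.∣ 28 * n + 17 * p
∤28n+17p {p} {n} p-prime p∤28 p∤n p∣28n+17p =
  [ p∤28 , p∤n ]′ (euclidsLemma 28 n p-prime
    (∣m+n∣m⇒∣n (subst (p ℕD.∣_) (+-comm (28 * n) (17 * p)) p∣28n+17p) (n∣m*n 17)))

theorem6p3 : (c : ℕ → ℤ) → IsReciprocalCoeffs 9 5 c →
    (p : ℕ) → Prime p → (p % 28 ≡ 15 ⊎ p % 28 ≡ 27) →
    (n k : ℕ) → ¬ (p ℕD.∣ n) →
    (+ 2) ∣ c (8 * p ^ (2 * k + 1) * n + (34 * p ^ (2 * k + 2) + 1) / 7)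
theorem6p3 c c-reciprocal p p-prime p%28 n k p∤n =
  let p%4≡3 , (s , p²≡) , p∤28 = 15-or-27-mod-28 p%28
      t , p²ᵏ⁺²≡ = power≡1-mod 56 {s} p²≡ (suc k)
      p^[2k+2]≡ = trans (m^[2k+2]≡[m*m]^[1+k] p k) p²ᵏ⁺²≡
      m = p ^ (2 * k + 1) * n + 34 * t
  in  subst (λ i → + 2 ∣ c i) (sym (index≡8m+5 p k n t p^[2k+2]≡))
        (parity≡false⇒2∣ (c (8 * m + 5))
          (trans (parity-c[8m+5]≡P·Q c c-reciprocal m)
                 (P·Q-vanishes k m (28 * n + 17 * p) p-prime p%4≡3 (∤28n+17p p-prime p∤28 p∤n) (28m+17≡ p k n t p^[2k+2]≡))))
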